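{- Let $q$ be a prime power and $n,k\geq1$ integers. Let $f\in B[z_1,\dots,z_n]$ be a nonzero polynomial whose leading term with respect to the lexicographic monomial order (with $z_1>z_2>\dots>z_n$) is $c_\alpha z^\alpha$, where $\alpha=(\alpha_1,\dots,\alpha_n)$ with $\alpha_j<q^k$ for all $j$. Then for every $0<\theta\leq1$, the number of $y\in C^n$ such that $v_X(f(y))\geq v_X(c_\alpha)+\theta nq^k$ is less than \[\max\{q^{nk},\ |\alpha|\,k\,q^{k(n-1)+1}/\theta\},\] where $|\alpha|=\alpha_1+\dots+\alpha_n$.
   Context: $B=\mathbb{F}_q[X]$, and $v_X$ denotes the $X$-adic valuation on $B$ (the largest power of $X$ dividing a polynomial, with $v_X(0)=+\infty$). $A_k=\{a_0+a_1t+\dots+a_{k-1}t^{k-1}: a_j\in\mathbb{F}_q\}$. To each $a=\sum_{j=0}^{k-1}a_jt^j\in A_k$ associate $s_a=\sum_{j=0}^{k-1}a_jX^{q^j}\in B$, and let $C=\{s_a: a\in A_k\}\subseteq B$.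
   Formalization: The parameter θ ranges over the rationals with $0<\theta\leq1$. -}

module Defs where

open import Data.Nat as ℕ using (ℕ; zero; suc; _^_)
open import Data.Nat.Primality using (Prime)
open import Data.Fin using (Fin)
open import Data.List as List using (List; []; _∷_; _++_; replicate; length; upTo; concatMap)
open import Data.Vec as Vec using (Vec; []; _∷_)
open import Data.Product using (Σ; ∃; _×_; _,_)
open import Data.Sum using (_⊎_)
open import Data.Empty using (⊥)
open import Relation.Nullary using (¬_)
open import Relation.Binary.PropositionalEquality using (_≡_; _≢_)
open import Function.Bundles using (_⤖_)
open import Algebra.Structures using (IsCommutativeRing)
open import Data.Integer as ℤ using (ℤ)
open import Data.Rational as ℚ using (ℚ)
open import Data.Rational.Properties using (pos⇒nonZero)

IsPrimePower : ℕ → Set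
IsPrimePower q = Σ ℕ λ p → Σ ℕ λ e → Prime p × (1 ℕ.≤ e) × (q ≡ p ^ e)

-- A finite field with exactly q elements (equality is propositional;
-- every finite field is isomorphic to one presented this way).

record FiniteField (q : ℕ) : Set₁ where
  infixl 7 _*_
  infixl 6 _+_
  field
    Carrier           : Set
    _+_ _*_           : Carrier → Carrier → Carrier
    -_                : Carrier → Carrier
    0# 1#             : Carrier
    isCommutativeRing : IsCommutativeRing _≡_ _+_ _*_ -_ 0# 1#
    0≢1               : 0# ≢ 1#
    inverse           : ∀ x → x ≢ 0# → Σ Carrier λ y → x * y ≡ 1#
    enumeration       : Fin q ⤖ Carrier

ℕ→ℚ : ℕ → ℚ
ℕ→ℚ n = ℤ.+ n ℚ./ 1

divPos : ℚ → (θ : ℚ) → .{{ℚ.Positive θ}} → ℚ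
divPos x θ = ℚ._÷_ x θ {{pos⇒nonZero θ}}

_<lex_ : ∀ {n} → Vec ℕ n → Vec ℕ n → Set
[] <lex [] = ⊥
(a ∷ as) <lex (b ∷ bs) = (a ℕ.< b) ⊎ ((a ≡ b) × (as <lex bs))

allExps : (n D : ℕ) → List (Vec ℕ n)
allExps zero    D = [] ∷ []
allExps (suc n) D = concatMap (λ i → List.map (i ∷_) (allExps n D)) (upTo D)

-- B = F_q[X], univariate polynomials as coefficient lists (constant
-- term first); two lists represent the same polynomial iff they have
-- the same coefficients (trailing zeros are irrelevant).

module Poly {q : ℕ} (F : FiniteField q) where
  open FiniteField F

  B : Set
  B = List Carrier

  coeff : B → ℕ → Carrier
  coeff []       _       = 0#
  coeff (x ∷ xs) zero    = x
  coeff (x ∷ xs) (suc i) = coeff xs i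

  _≈B_ : B → B → Set
  a ≈B b = ∀ i → coeff a i ≡ coeff b i

  _≉B_ : B → B → Set
  a ≉B b = ¬ (a ≈B b)

  0B 1B : B
  0B = []
  1B = 1# ∷ []

  _+B_ : B → B → B
  []       +B ys       = ys
  (x ∷ xs) +B []       = x ∷ xs
  (x ∷ xs) +B (y ∷ ys) = (x + y) ∷ (xs +B ys)

  _*B_ : B → B → B
  []       *B ys = []
  (x ∷ xs) *B ys = List.map (x *_) ys +B (0# ∷ (xs *B ys))

  _^B_ : B → ℕ → B
  b ^B zero  = 1B
  b ^B suc e = b *B (b ^B e)

  monomial : Carrier → ℕ → B
  monomial c m = replicate m 0# ++ (c ∷ [])

  Xpow : ℕ → B
  Xpow m = monomial 1# m

  XPowDivides : ℕ → B → Set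
  XPowDivides m b = Σ B λ g → b ≈B (Xpow m *B g)

  IsValX : B → ℕ → Set
  IsValX b v = XPowDivides v b × ¬ XPowDivides (suc v) b

  -- v_X(b) ≥ t for a rational t (v_X(0) = +∞): some X^m with m ≥ t divides b
  ValXAtLeast : B → ℚ → Set
  ValXAtLeast b t = Σ ℕ λ m → (t ℚ.≤ ℕ→ℚ m) × XPowDivides m b

  -- A_k and the map a ↦ s_a = Σ_j a_j X^{q^j}

  sA-from : ℕ → ∀ {k} → Vec Carrier k → B
  sA-from j []       = 0B
  sA-from j (a ∷ as) = monomial a (q ^ j) +B sA-from (suc j) as

  sA : ∀ {k} → Vec Carrier k → B
  sA = sA-from 0

  InC : ℕ → B → Set
  InC k b = Σ (Vec Carrier k) λ a → b ≈B sA a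

  record MPoly (n : ℕ) : Set where
    field
      cf       : Vec ℕ n → B
      bound    : ℕ
      support  : ∀ β → (Σ (Fin n) λ j → bound ℕ.≤ Vec.lookup β j) → cf β ≈B 0B

  open MPoly public

  monoVal : ∀ {n} → Vec B n → Vec ℕ n → B
  monoVal []       []       = 1B
  monoVal (y ∷ ys) (e ∷ es) = (y ^B e) *B monoVal ys es

  sumB : List B → B
  sumB = List.foldr _+B_ 0B

  eval : ∀ {n} → MPoly n → Vec B n → B
  eval {n} f y = sumB (List.map (λ β → cf f β *B monoVal y β) (allExps n (bound f)))

  IsLeadingTerm : ∀ {n} → MPoly n → Vec ℕ n → Set
  IsLeadingTerm f α = (cf f α ≉B 0B) × (∀ β → α <lex β → cf f β ≈B 0B)

  _≈V_ : ∀ {n} → Vec B n → Vec B n → Set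
  y ≈V y' = ∀ j → Vec.lookup y j ≈B Vec.lookup y' j

  InCn : (n k : ℕ) → Vec B n → Set
  InCn n k y = ∀ (j : Fin n) → InC k (Vec.lookup y j)

{-# OPTIONS --safe #-}
-- If k |α| ≥ θ n q^k, the bound already follows from |Cⁿ| = q^(nk).  Otherwise, if the y's
-- exhausted Cⁿ, f would vanish modulo X^(v + 1 + k |α|) on the grid of points whose j-th
-- coordinate is s_m for the m ∈ A_k carrying the base-q digits of some mⱼ ≤ αⱼ.  Newton's
-- divided differences in z₁ recover the coefficient of z₁^α₁ from these values, and the
-- step at s_m, s_m′ loses only v_X(s_m − s_m′) ≤ q^t, where t is the first digit in which
-- the two indices differ; summed over all steps this is at most k α₁.  Repeating this for
-- z₂, …, zₙ gives X^(v+1) ∣ c_α, contradicting v_X(c_α) = v.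
module Submission where

open import Defs
open import Algebra.Bundles using (CommutativeRing)
open import Data.Empty using (⊥-elim)
open import Data.Fin as Fin using (Fin; toℕ)
import Data.Fin.Properties as Fin
import Data.Integer as ℤ
import Data.Integer.Properties as ℤ
open import Data.List as List using (List; []; _∷_; _++_; length; applyUpTo; upTo; concatMap)
import Data.List.Properties as List
open import Data.List.Membership.Propositional using (_∈_)
open import Data.List.Relation.Unary.All as All using (All; []; _∷_)
open import Data.List.Relation.Unary.All.Properties using (¬Any⇒All¬)
open import Data.List.Relation.Unary.AllPairs using (AllPairs; []; _∷_)
open import Data.List.Relation.Unary.Any using (any?; here; there)
open import Data.Maybe using (nothing)
open import Data.Nat as ℕ
  using (ℕ; zero; suc; _≤_; _<_; z≤n; s≤s; s≤s⁻¹; _+_; _*_; _∸_; _^_; _/_; _%_; NonZero; >-nonZero; ≢-nonZero)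
open import Data.Nat.Coprimality as Coprimality using (1-coprimeTo)
open import Data.Nat.Divisibility using (_∣_; divides; ∣-trans; 1∣_; *-monoʳ-∣)
open import Data.Nat.DivMod
open import Data.Nat.Primality using (prime)
open import Data.Nat.Properties
open import Data.Nat.Tactic.RingSolver using (solve-∀)
open import Data.Product using (Σ; _×_; _,_; proj₁; proj₂)
open import Data.Rational as ℚ using (ℚ; mkℚ; Positive; NonNegative; 1/_)
import Data.Rational.Properties as ℚ
import Data.Rational.Unnormalised as ℚᵘ
import Data.Rational.Unnormalised.Properties as ℚᵘ
open import Data.Sum using (inj₁; inj₂)
open import Data.Vec as Vec using (Vec; []; _∷_; sum)
import Data.Vec.Properties as Vec
open import Data.Vec.Relation.Binary.Pointwise.Inductive using (Pointwise; []; _∷_)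
import Data.Vec.Relation.Unary.All as VAll
open import Function.Base using (_∘_)
open import Function.Bundles using (module Bijection; module Surjection)
open import Function.Definitions using (Injective)
open import Relation.Binary.Bundles using (Setoid)
open import Relation.Binary.Definitions using (DecidableEquality; tri<; tri≈; tri>)
open import Relation.Binary.PropositionalEquality
import Relation.Binary.Reasoning.Setoid as SetoidReasoning
open import Relation.Binary.Structures using (IsEquivalence)
open import Relation.Nullary using (¬_; yes; no; contradiction)
open import Relation.Nullary.Decidable using (map′)
open import Tactic.RingSolver.Core.AlmostCommutativeRing using (AlmostCommutativeRing; fromCommutativeRing)
open import Algebra.Properties.CommutativeSemigroup +-commutativeSemigroup
  using () renaming (interchange to +-interchange)

ℕ→ℚᶜ : ℕ → ℚ
ℕ→ℚᶜ n = mkℚ (ℤ.+ n) 0 (Coprimality.sym (1-coprimeTo n))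

ℕ→ℚ≡ℕ→ℚᶜ : ∀ n → ℕ→ℚ n ≡ ℕ→ℚᶜ n
ℕ→ℚ≡ℕ→ℚᶜ n = ℚ.normalize-coprime (Coprimality.sym (1-coprimeTo n))

ℕ→ℚ-mono-< : ∀ {m n} → m < n → ℕ→ℚ m ℚ.< ℕ→ℚ n
ℕ→ℚ-mono-< {m} {n} m<n rewrite ℕ→ℚ≡ℕ→ℚᶜ m | ℕ→ℚ≡ℕ→ℚᶜ n =
  ℚ.*<* (subst₂ ℤ._<_ (sym (ℤ.*-identityʳ (ℤ.+ m))) (sym (ℤ.*-identityʳ (ℤ.+ n))) (ℤ.+<+ m<n))

ℕ→ℚ-cancel-< : ∀ {m n} → ℕ→ℚ m ℚ.< ℕ→ℚ n → m < n
ℕ→ℚ-cancel-< {m} {n} m<n rewrite ℕ→ℚ≡ℕ→ℚᶜ m | ℕ→ℚ≡ℕ→ℚᶜ n with m<n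
... | ℚ.*<* m*1<n*1 with subst₂ ℤ._<_ (ℤ.*-identityʳ (ℤ.+ m)) (ℤ.*-identityʳ (ℤ.+ n)) m*1<n*1
...   | ℤ.+<+ m<n′ = m<n′

ℕ→ℚ-homo-+ : ∀ m n → ℕ→ℚ (m + n) ≡ ℕ→ℚ m ℚ.+ ℕ→ℚ n
ℕ→ℚ-homo-+ m n rewrite ℕ→ℚ≡ℕ→ℚᶜ (m + n) | ℕ→ℚ≡ℕ→ℚᶜ m | ℕ→ℚ≡ℕ→ℚᶜ n =
  ℚ.toℚᵘ-injective (ℚᵘ.≃-trans (ℚᵘ.*≡* numerators) (ℚᵘ.≃-sym (ℚ.toℚᵘ-homo-+ (ℕ→ℚᶜ m) (ℕ→ℚᶜ n))))
  where
  numerators : ℤ.+ (m + n) ℤ.* ℤ.+ 1 ≡ (ℤ.+ m ℤ.* ℤ.+ 1 ℤ.+ ℤ.+ n ℤ.* ℤ.+ 1) ℤ.* ℤ.+ 1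
  numerators = begin
    ℤ.+ (m + n) ℤ.* ℤ.+ 1                         ≡⟨ ℤ.*-identityʳ _ ⟩
    ℤ.+ m ℤ.+ ℤ.+ n                               ≡⟨ cong₂ ℤ._+_ (ℤ.*-identityʳ (ℤ.+ m)) (ℤ.*-identityʳ (ℤ.+ n)) ⟨
    ℤ.+ m ℤ.* ℤ.+ 1 ℤ.+ ℤ.+ n ℤ.* ℤ.+ 1           ≡⟨ ℤ.*-identityʳ _ ⟨
    (ℤ.+ m ℤ.* ℤ.+ 1 ℤ.+ ℤ.+ n ℤ.* ℤ.+ 1) ℤ.* ℤ.+ 1 ∎
    where open ≡-Reasoning

ℕ→ℚ-homo-* : ∀ m n → ℕ→ℚ (m * n) ≡ ℕ→ℚ m ℚ.* ℕ→ℚ n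
ℕ→ℚ-homo-* m n rewrite ℕ→ℚ≡ℕ→ℚᶜ (m * n) | ℕ→ℚ≡ℕ→ℚᶜ m | ℕ→ℚ≡ℕ→ℚᶜ n =
  ℚ.toℚᵘ-injective (ℚᵘ.≃-trans (ℚᵘ.*≡* (cong (ℤ._* ℤ.+ 1) (ℤ.pos-* m n)))
                               (ℚᵘ.≃-sym (ℚ.toℚᵘ-homo-* (ℕ→ℚᶜ m) (ℕ→ℚᶜ n))))

ℕ→ℚ-nonNeg : ∀ n → NonNegative (ℕ→ℚ n)
ℕ→ℚ-nonNeg n = subst NonNegative (sym (ℕ→ℚ≡ℕ→ℚᶜ n)) _

ℕ→ℚ-pos : ∀ n → .{{NonZero n}} → Positive (ℕ→ℚ n)
ℕ→ℚ-pos (suc n) = subst Positive (sym (ℕ→ℚ≡ℕ→ℚᶜ (suc n))) _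

<-divPos : ∀ x y θ .{{_ : Positive θ}} → x ℚ.* θ ℚ.< y → x ℚ.< divPos y θ
<-divPos x y θ xθ<y = begin-strict
  x                     ≡⟨ ℚ.*-identityʳ x ⟨
  x ℚ.* ℚ.1ℚ            ≡⟨ cong (x ℚ.*_) (ℚ.*-inverseʳ θ) ⟨
  x ℚ.* (θ ℚ.* 1/ θ)    ≡⟨ ℚ.*-assoc x θ (1/ θ) ⟨
  (x ℚ.* θ) ℚ.* (1/ θ)  <⟨ ℚ.*-monoˡ-<-pos (1/ θ) xθ<y ⟩
  y ℚ.* (1/ θ)          ∎
  where
  open ℚ.≤-Reasoning
  instance
    θ≢0 : ℚ.NonZero θ
    θ≢0 = ℚ.pos⇒nonZero θ
    1/θ>0 : Positive (1/ θ)
    1/θ>0 = ℚ.1/pos⇒pos θ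

Σ< : ℕ → (ℕ → ℕ) → ℕ
Σ< zero    f = 0
Σ< (suc k) f = Σ< k f + f k

syntax Σ< k (λ t → e) = ∑[ t < k ] e

Σ<-cong : ∀ k {f h : ℕ → ℕ} → (∀ t → f t ≡ h t) → Σ< k f ≡ Σ< k h
Σ<-cong zero    f≡h = refl
Σ<-cong (suc k) f≡h = cong₂ _+_ (Σ<-cong k f≡h) (f≡h k)

Σ<-distrib-+ : ∀ k (f h : ℕ → ℕ) → (∑[ t < k ] (f t + h t)) ≡ Σ< k f + Σ< k h
Σ<-distrib-+ zero    f h = refl
Σ<-distrib-+ (suc k) f h = trans (cong (_+ (f k + h k)) (Σ<-distrib-+ k f h))
                                 (+-interchange (Σ< k f) (Σ< k h) (f k) (h k))

Σ<-zero : ∀ k (f : ℕ → ℕ) → (∀ t → f t ≡ 0) → Σ< k f ≡ 0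
Σ<-zero zero    f f≡0 = refl
Σ<-zero (suc k) f f≡0 = cong₂ _+_ (Σ<-zero k f f≡0) (f≡0 k)

Σ<-mono-≤ : ∀ k {f h : ℕ → ℕ} → (∀ t → t < k → f t ≤ h t) → Σ< k f ≤ Σ< k h
Σ<-mono-≤ zero    f≤h = z≤n
Σ<-mono-≤ (suc k) f≤h = +-mono-≤ (Σ<-mono-≤ k (λ t t<k → f≤h t (m<n⇒m<1+n t<k))) (f≤h k (n<1+n k))

Σ<-≤-* : ∀ k {f : ℕ → ℕ} c → (∀ t → t < k → f t ≤ c) → Σ< k f ≤ k * c
Σ<-≤-* zero    c f≤c = z≤n
Σ<-≤-* (suc k) c f≤c = ≤-trans (+-mono-≤ (Σ<-≤-* k c (λ t t<k → f≤c t (m<n⇒m<1+n t<k))) (f≤c k (n<1+n k)))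
                               (≤-reflexive (+-comm (k * c) c))

Σ<-monoˡ-≤ : ∀ (f : ℕ → ℕ) {k k′} → k ≤ k′ → Σ< k f ≤ Σ< k′ f
Σ<-monoˡ-≤ f {k} k≤k′ with m≤n⇒∃[o]m+o≡n k≤k′
... | o , refl = extend o
  where
  extend : ∀ o → Σ< k f ≤ Σ< (k + o) f
  extend zero    = ≤-reflexive (cong (λ k → Σ< k f) (sym (+-identityʳ k)))
  extend (suc o) = ≤-trans (extend o) (≤-trans (m≤m+n _ (f (k + o)))
                                        (≤-reflexive (cong (λ k → Σ< k f) (sym (+-suc k o)))))

^-monoʳ-∣ : ∀ q {s t} → s ≤ t → q ^ s ∣ q ^ t
^-monoʳ-∣ q {s} {t} s≤t = divides (q ^ (t ∸ s)) (begin
  q ^ t                 ≡⟨ cong (q ^_) (m+[n∸m]≡n s≤t) ⟨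
  q ^ (s + (t ∸ s))     ≡⟨ ^-distribˡ-+-* q s (t ∸ s) ⟩
  q ^ s * q ^ (t ∸ s)   ≡⟨ *-comm (q ^ s) _ ⟩
  q ^ (t ∸ s) * q ^ s   ∎)
  where open ≡-Reasoning

∸-split : ∀ a b c → c ≤ b → b ≤ a → a ∸ c ≡ (a ∸ b) + (b ∸ c)
∸-split a b c c≤b b≤a = +-cancelʳ-≡ c _ _ (begin
  a ∸ c + c             ≡⟨ m∸n+n≡m (≤-trans c≤b b≤a) ⟩
  a                     ≡⟨ m∸n+n≡m b≤a ⟨
  (a ∸ b) + b           ≡⟨ cong ((a ∸ b) +_) (m∸n+n≡m c≤b) ⟨
  (a ∸ b) + (b ∸ c + c) ≡⟨ +-assoc (a ∸ b) (b ∸ c) c ⟨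
  (a ∸ b) + (b ∸ c) + c ∎)
  where open ≡-Reasoning

/-superadditive : ∀ m n d .{{_ : NonZero d}} → m / d + n / d ≤ (m + n) / d
/-superadditive m n d = ≤-trans (≤-reflexive (sym (m*n/n≡m _ d))) (/-monoˡ-≤ d (begin
  (m / d + n / d) * d     ≡⟨ *-distribʳ-+ d (m / d) (n / d) ⟩
  m / d * d + n / d * d   ≤⟨ +-mono-≤ (m/n*n≤m m d) (m/n*n≤m n d) ⟩
  m + n                   ∎))
  where open ≤-Reasoning

module BaseQ (q : ℕ) .{{_ : NonZero q}} where

  infixl 7 _/q^_
  _/q^_ : ℕ → ℕ → ℕ
  m /q^ t = (m / q ^ t) {{m^n≢0 q t}}

  weight : ℕ → ℕ
  weight zero    = 1
  weight (suc t) = q ^ suc t ∸ q ^ t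

  weight≤q^ : ∀ t → weight t ≤ q ^ t
  weight≤q^ zero    = ≤-refl
  weight≤q^ (suc t) = m∸n≤m (q ^ suc t) (q ^ t)

  Σ<-weight : ∀ t → Σ< (suc t) weight ≡ q ^ t
  Σ<-weight zero    = refl
  Σ<-weight (suc t) = trans (cong (_+ weight (suc t)) (Σ<-weight t))
                            (trans (+-comm (q ^ t) _) (m∸n+n≡m (^-monoʳ-≤ q (n≤1+n t))))

  -- jump t m is 1 when q ^ t ∣ m (and m ≥ 1), and 0 otherwise.
  jump : ℕ → ℕ → ℕ
  jump t m = m /q^ t ∸ (m ∸ 1) /q^ t

  jump-pos : ∀ t m → q ^ t ∣ m → 1 ≤ m → 1 ≤ jump t m
  jump-pos t _ (divides r refl) 1≤m = ≤-trans (m<n⇒0<n∸m quotient<)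
    (≤-reflexive (cong (_∸ (r * q ^ t ∸ 1) /q^ t) (sym (m*n/n≡m r (q ^ t)))))
    where
    instance
      q^t≢0 : NonZero (q ^ t)
      q^t≢0 = m^n≢0 q t
    quotient< : (r * q ^ t ∸ 1) /q^ t < r
    quotient< = m<n*o⇒m/o<n (∸-monoʳ-< (s≤s z≤n) 1≤m)

  -- For m ≥ 1, gap k m = q ^ s where s is the largest s < k with q ^ s ∣ m.
  gap : ℕ → ℕ → ℕ
  gap k m = ∑[ t < k ] (weight t * jump t m)

  q^≤gap : ∀ k t m → t < k → q ^ t ∣ m → 1 ≤ m → q ^ t ≤ gap k m
  q^≤gap k t m t<k q^t∣m 1≤m = begin
    q ^ t                                ≡⟨ Σ<-weight t ⟨
    Σ< (suc t) weight                    ≤⟨ Σ<-mono-≤ (suc t) weight≤summand ⟩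
    ∑[ s < suc t ] (weight s * jump s m) ≤⟨ Σ<-monoˡ-≤ _ t<k ⟩
    gap k m                              ∎
    where
    open ≤-Reasoning
    weight≤summand : ∀ s → s < suc t → weight s ≤ weight s * jump s m
    weight≤summand s s≤t = ≤-trans (≤-reflexive (sym (*-identityʳ (weight s))))
      (*-monoʳ-≤ (weight s) (jump-pos s m (∣-trans (^-monoʳ-∣ q (s≤s⁻¹ s≤t)) q^t∣m) 1≤m))

  -- Φ k i j = ∑_{l<j} gap k (i ∸ l), see Φ-suc.
  Φ : ℕ → ℕ → ℕ → ℕ
  Φ k i j = ∑[ t < k ] (weight t * (i /q^ t ∸ (i ∸ j) /q^ t))

  Φ-zero : ∀ k i → Φ k i 0 ≡ 0
  Φ-zero k i = Σ<-zero k _ (λ t → trans (cong (weight t *_) (n∸n≡0 (i /q^ t))) (*-zeroʳ (weight t)))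

  Φ-suc : ∀ k i j → j < i → Φ k i (suc j) ≡ Φ k i j + gap k (i ∸ j)
  Φ-suc k i j j<i = trans (Σ<-cong k (λ t → trans (cong (weight t *_) (split t)) (*-distribˡ-+ (weight t) _ _)))
                          (Σ<-distrib-+ k _ _)
    where
    split : ∀ t → i /q^ t ∸ (i ∸ suc j) /q^ t ≡ (i /q^ t ∸ (i ∸ j) /q^ t) + jump t (i ∸ j)
    split t = begin
      i /q^ t ∸ (i ∸ suc j) /q^ t
        ≡⟨ cong (λ m → i /q^ t ∸ m /q^ t) (trans (∸-+-assoc i j 1) (cong (i ∸_) (+-comm j 1))) ⟨
      i /q^ t ∸ (i ∸ j ∸ 1) /q^ t
        ≡⟨ ∸-split _ _ _ (/-monoˡ-≤ (q ^ t) (m∸n≤m (i ∸ j) 1)) (/-monoˡ-≤ (q ^ t) (m∸n≤m i j)) ⟩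
      (i /q^ t ∸ (i ∸ j) /q^ t) + jump t (i ∸ j) ∎
      where
      open ≡-Reasoning
      instance
        q^t≢0 : NonZero (q ^ t)
        q^t≢0 = m^n≢0 q t

  Φ-monoʳ : ∀ k {i} j → j ≤ i → Φ k j j ≤ Φ k i j
  Φ-monoʳ k {i} j j≤i = Σ<-mono-≤ k (λ t _ → *-monoʳ-≤ (weight t) (quotients t))
    where
    quotients : ∀ t → j /q^ t ∸ (j ∸ j) /q^ t ≤ i /q^ t ∸ (i ∸ j) /q^ t
    quotients t = begin
      j /q^ t ∸ (j ∸ j) /q^ t ≡⟨ cong (λ m → j /q^ t ∸ m /q^ t) (n∸n≡0 j) ⟩
      j /q^ t ∸ 0 /q^ t       ≡⟨ cong (j /q^ t ∸_) (0/n≡0 (q ^ t)) ⟩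
      j /q^ t                 ≡⟨ m+n∸n≡m (j /q^ t) ((i ∸ j) /q^ t) ⟨
      (j /q^ t + (i ∸ j) /q^ t) ∸ (i ∸ j) /q^ t
        ≤⟨ ∸-monoˡ-≤ ((i ∸ j) /q^ t) (≤-trans (/-superadditive j (i ∸ j) (q ^ t)) (≤-reflexive (cong (_/q^ t) (m+[n∸m]≡n j≤i)))) ⟩
      i /q^ t ∸ (i ∸ j) /q^ t ∎
      where
      open ≤-Reasoning
      instance
        q^t≢0 : NonZero (q ^ t)
        q^t≢0 = m^n≢0 q t

  Φ≤k*i : ∀ k i j → Φ k i j ≤ k * i
  Φ≤k*i k i j = Σ<-≤-* k i summand≤i
    where
    summand≤i : ∀ t → t < k → weight t * (i /q^ t ∸ (i ∸ j) /q^ t) ≤ i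
    summand≤i t _ = begin
      weight t * (i /q^ t ∸ (i ∸ j) /q^ t) ≤⟨ *-mono-≤ (weight≤q^ t) (m∸n≤m (i /q^ t) ((i ∸ j) /q^ t)) ⟩
      q ^ t * (i /q^ t)                     ≡⟨ *-comm (q ^ t) _ ⟩
      i /q^ t * q ^ t                       ≤⟨ m/n*n≤m i (q ^ t) ⟩
      i                                     ∎
      where
      open ≤-Reasoning
      instance
        q^t≢0 : NonZero (q ^ t)
        q^t≢0 = m^n≢0 q t

module _ {A : Set} where

  All-lookup : ∀ {P : A → Set} {xs} → All P xs → (i : Fin (length xs)) → P (List.lookup xs i)
  All-lookup (px ∷ _)   Fin.zero    = px
  All-lookup (_  ∷ pxs) (Fin.suc i) = All-lookup pxs i

  AllPairs-lookup : ∀ {R : A → A → Set} {xs} → AllPairs R xs →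
                    ∀ i j → toℕ i < toℕ j → R (List.lookup xs i) (List.lookup xs j)
  AllPairs-lookup (Rx ∷ _)   Fin.zero    (Fin.suc j) _         = All-lookup Rx j
  AllPairs-lookup (_  ∷ Rxs) (Fin.suc i) (Fin.suc j) (s≤s i<j) = AllPairs-lookup Rxs i j i<j

  length-distinct≤ : ∀ {N} (enc : A → Fin N) → Injective _≡_ _≡_ enc →
                     ∀ {xs} → AllPairs _≢_ xs → length xs ≤ N
  length-distinct≤ {N} enc enc-inj {xs} distinct with length xs ≤? N
  ... | yes ≤N = ≤N
  ... | no ≰N with Fin.pigeonhole (≰⇒> ≰N) (λ i → enc (List.lookup xs i))
  ...   | i , j , i<j , same = contradiction (enc-inj same) (AllPairs-lookup distinct i j i<j)

  encodeVec : ∀ {a} → (A → Fin a) → ∀ {m} → Vec A m → Fin (a ^ m)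
  encodeVec enc []       = Fin.zero
  encodeVec enc (x ∷ xs) = Fin.combine (enc x) (encodeVec enc xs)

  encodeVec-injective : ∀ {a} (enc : A → Fin a) → Injective _≡_ _≡_ enc →
                        ∀ {m} → Injective _≡_ _≡_ (encodeVec enc {m})
  encodeVec-injective enc enc-inj {x = []}     {[]}     _    = refl
  encodeVec-injective enc enc-inj {x = x ∷ xs} {y ∷ ys} same
    with Fin.combine-injective (enc x) (encodeVec enc xs) (enc y) (encodeVec enc ys) same
  ... | x≡y , xs≡ys = cong₂ _∷_ (enc-inj x≡y) (encodeVec-injective enc enc-inj xs≡ys)

  distinct-complete : ∀ {N} (enc : A → Fin N) → Injective _≡_ _≡_ enc →
                      ∀ {xs} → AllPairs _≢_ xs → N ≤ length xs → ∀ x → x ∈ xs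
  distinct-complete enc enc-inj {xs} distinct N≤length x
    with any? (λ y → map′ enc-inj (cong enc) (enc x Fin.≟ enc y)) xs
  ... | yes x∈xs = x∈xs
  ... | no  x∉xs = contradiction N≤length
                     (<⇒≱ (length-distinct≤ enc enc-inj (¬Any⇒All¬ xs x∉xs ∷ distinct)))

^-injectiveʳ : ∀ q → 2 ≤ q → ∀ {s t} → q ^ s ≡ q ^ t → s ≡ t
^-injectiveʳ q 2≤q {s} {t} q^s≡q^t with <-cmp s t
... | tri≈ _ s≡t _ = s≡t
... | tri< s<t _ _ = contradiction q^s≡q^t (<⇒≢ (^-monoʳ-< q 2≤q s<t))
... | tri> _ _ t<s = contradiction (sym q^s≡q^t) (<⇒≢ (^-monoʳ-< q 2≤q t<s))

module Digits (q : ℕ) .{{_ : NonZero q}} where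

  -- Base-q digits, least significant first.
  digits : (k m : ℕ) → Vec (Fin q) k
  digits zero    m = []
  digits (suc k) m = Fin.fromℕ< (m%n<n m q) ∷ digits k (m / q)

  firstDifferingDigit : ∀ k i l → i < q ^ k → l < i →
    Σ (Fin k) λ t → (q ^ toℕ t ∣ i ∸ l) × (Vec.lookup (digits k i) t ≢ Vec.lookup (digits k l) t)
  firstDifferingDigit zero    i l i<1 l<i = contradiction (≤-trans (s≤s z≤n) l<i) (<⇒≱ i<1)
  firstDifferingDigit (suc k) i l i<q^k+1 l<i with i % q ≟ l % q
  ... | no i%q≢l%q = Fin.zero , 1∣ (i ∸ l) , λ same → i%q≢l%q (begin
    i % q                               ≡⟨ Fin.toℕ-fromℕ< (m%n<n i q) ⟨
    toℕ (Fin.fromℕ< (m%n<n i q))        ≡⟨ cong toℕ same ⟩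
    toℕ (Fin.fromℕ< (m%n<n l q))        ≡⟨ Fin.toℕ-fromℕ< (m%n<n l q) ⟩
    l % q                               ∎)
    where open ≡-Reasoning
  ... | yes i%q≡l%q with firstDifferingDigit k (i / q) (l / q) i/q<q^k l/q<i/q
    where
    i/q<q^k : i / q < q ^ k
    i/q<q^k = m<n*o⇒m/o<n (<-≤-trans i<q^k+1 (≤-reflexive (*-comm q (q ^ k))))
    l/q<i/q : l / q < i / q
    l/q<i/q = *-cancelʳ-< _ (l / q) (i / q) (+-cancelˡ-< (l % q) _ _
      (subst (λ r → l % q + l / q * q < r + i / q * q) i%q≡l%q
        (subst₂ _<_ (m≡m%n+[m/n]*n l q) (m≡m%n+[m/n]*n i q) l<i)))
  ... | t , q^t∣ , differ = Fin.suc t , subst (q ^ suc (toℕ t) ∣_) (sym i∸l≡q*[i/q∸l/q]) (*-monoʳ-∣ q q^t∣) , differ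
    where
    i∸l≡q*[i/q∸l/q] : i ∸ l ≡ q * (i / q ∸ l / q)
    i∸l≡q*[i/q∸l/q] = begin
      i ∸ l                                     ≡⟨ cong₂ _∸_ (m≡m%n+[m/n]*n i q)
                                                     (trans (m≡m%n+[m/n]*n l q) (cong (_+ l / q * q) (sym i%q≡l%q))) ⟩
      (i % q + i / q * q) ∸ (i % q + l / q * q) ≡⟨ [m+n]∸[m+o]≡n∸o (i % q) _ _ ⟩
      i / q * q ∸ l / q * q                     ≡⟨ *-distribʳ-∸ q (i / q) (l / q) ⟨
      (i / q ∸ l / q) * q                       ≡⟨ *-comm _ q ⟩
      q * (i / q ∸ l / q)                       ∎
      where open ≡-Reasoning

IsPrimePower⇒2≤ : ∀ {q} → IsPrimePower q → 2 ≤ q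
IsPrimePower⇒2≤ (p , e , prime {{p>1}} _ , 1≤e , refl) =
  ≤-trans (ℕ.nonTrivial⇒n>1 p) (≤-trans (≤-reflexive (sym (*-identityʳ p))) (^-monoʳ-≤ p 1≤e))
  where
  instance
    p≢0 : NonZero p
    p≢0 = ℕ.nonTrivial⇒nonZero p

ValXAtLeast-threshold : ∀ v c m (x : ℚ) → ℕ→ℚ c ℚ.< x → ℕ→ℚ v ℚ.+ x ℚ.≤ ℕ→ℚ m → v + c < m
ValXAtLeast-threshold v c m x c<x v+x≤m = ℕ→ℚ-cancel-< (ℚ.<-≤-trans
  (subst (ℚ._< ℕ→ℚ v ℚ.+ x) (sym (ℕ→ℚ-homo-+ v c)) (ℚ.+-monoʳ-< (ℕ→ℚ v) c<x)) v+x≤m)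

-- The right-hand side is the left-hand side multiplied by n q ≥ 2.
q^nk*kA<bound*nq^k : ∀ q n k A → 2 ≤ q → .{{NonZero n}} → .{{NonZero (k * A)}} →
  q ^ (n * k) * (k * A) < A * k * q ^ (k * (n ∸ 1) + 1) * (n * q ^ k)
q^nk*kA<bound*nq^k q n@(suc n′) k A 2≤q = begin-strict
  q ^ (n * k) * (k * A)                             <⟨ m<m*n _ (n * q) (<-≤-trans 2≤q (m≤n*m q n)) ⟩
  q ^ (n * k) * (k * A) * (n * q)                   ≡⟨ regroup ⟩
  A * k * q ^ (k * n′ + 1) * (n * q ^ k)            ∎
  where
  open ≤-Reasoning
  instance
    q≢0 : NonZero q
    q≢0 = >-nonZero (≤-trans (s≤s z≤n) 2≤q)
    q^nk*kA≢0 : NonZero (q ^ (n * k) * (k * A))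
    q^nk*kA≢0 = m*n≢0 (q ^ (n * k)) (k * A) {{m^n≢0 q (n * k)}}
  regroup : q ^ (n * k) * (k * A) * (n * q) ≡ A * k * q ^ (k * n′ + 1) * (n * q ^ k)
  regroup = begin-equality
    q ^ (n * k) * (k * A) * (n * q)
      ≡⟨ cong (λ e → q ^ e * (k * A) * (n * q)) (trans (*-comm n k) (*-suc k n′)) ⟩
    q ^ (k + k * n′) * (k * A) * (n * q)
      ≡⟨ cong (λ x → x * (k * A) * (n * q)) (^-distribˡ-+-* q k (k * n′)) ⟩
    q ^ k * q ^ (k * n′) * (k * A) * (n * q)
      ≡⟨ shuffle (q ^ k) (q ^ (k * n′)) k A n q ⟩
    A * k * (q ^ (k * n′) * q) * (n * q ^ k)
      ≡⟨ cong (λ x → A * k * x * (n * q ^ k)) (trans (cong (q ^ (k * n′) *_) (sym (*-identityʳ q)))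
                                                     (sym (^-distribˡ-+-* q (k * n′) 1))) ⟩
    A * k * q ^ (k * n′ + 1) * (n * q ^ k) ∎
    where
    shuffle : ∀ a b c d e f → a * b * (c * d) * (e * f) ≡ d * c * (b * f) * (e * a)
    shuffle = solve-∀

≤q^nk⇒<bound/θ : ∀ q n k A L (θ : ℚ) .{{_ : Positive θ}} → 2 ≤ q → .{{NonZero n}} →
  θ ℚ.* ℕ→ℚ (n * q ^ k) ℚ.≤ ℕ→ℚ (k * A) → L ≤ q ^ (n * k) →
  ℕ→ℚ L ℚ.< divPos (ℕ→ℚ (A * k * q ^ (k * (n ∸ 1) + 1))) θ
≤q^nk⇒<bound/θ q n k A L θ 2≤q θM≤kA L≤N = <-divPos (ℕ→ℚ L) (ℕ→ℚ S) θ (ℚ.*-cancelʳ-<-nonNeg (ℕ→ℚ M) (begin-strict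
  ℕ→ℚ L ℚ.* θ ℚ.* ℕ→ℚ M    ≡⟨ ℚ.*-assoc (ℕ→ℚ L) θ (ℕ→ℚ M) ⟩
  ℕ→ℚ L ℚ.* (θ ℚ.* ℕ→ℚ M)  ≤⟨ ℚ.*-monoˡ-≤-nonNeg (ℕ→ℚ L) θM≤kA ⟩
  ℕ→ℚ L ℚ.* ℕ→ℚ (k * A)    ≡⟨ ℕ→ℚ-homo-* L (k * A) ⟨
  ℕ→ℚ (L * (k * A))        <⟨ ℕ→ℚ-mono-< (≤-<-trans (*-monoˡ-≤ (k * A) L≤N) (q^nk*kA<bound*nq^k q n k A 2≤q)) ⟩
  ℕ→ℚ (S * M)              ≡⟨ ℕ→ℚ-homo-* S M ⟩
  ℕ→ℚ S ℚ.* ℕ→ℚ M          ∎))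
  where
  open ℚ.≤-Reasoning
  M S : ℕ
  M = n * q ^ k
  S = A * k * q ^ (k * (n ∸ 1) + 1)
  instance
    L≥0 : NonNegative (ℕ→ℚ L)
    L≥0 = ℕ→ℚ-nonNeg L
    M≥0 : NonNegative (ℕ→ℚ M)
    M≥0 = ℕ→ℚ-nonNeg M
    q≢0 : NonZero q
    q≢0 = >-nonZero (≤-trans (s≤s z≤n) 2≤q)
    q^k≢0 : NonZero (q ^ k)
    q^k≢0 = m^n≢0 q k
    M≢0 : NonZero M
    M≢0 = m*n≢0 n (q ^ k)
    M>0 : Positive (ℕ→ℚ M)
    M>0 = ℕ→ℚ-pos M
    kA≢0 : NonZero (k * A)
    kA≢0 = ≢-nonZero λ kA≡0 → ℚ.<-irrefl refl (ℚ.<-≤-trans (ℚ.positive⁻¹ (θ ℚ.* ℕ→ℚ M) {{ℚ.pos*pos⇒pos θ (ℕ→ℚ M)}})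
                                                            (subst (λ c → θ ℚ.* ℕ→ℚ M ℚ.≤ ℕ→ℚ c) kA≡0 θM≤kA))

module Elements {q : ℕ} (F : FiniteField q) where
  open FiniteField F using (Carrier; enumeration; isCommutativeRing)

  F-commutativeRing : CommutativeRing _ _
  F-commutativeRing = record { isCommutativeRing = isCommutativeRing }

  element : Fin q → Carrier
  element = Bijection.to enumeration

  index : Carrier → Fin q
  index = Bijection.to⁻ enumeration

  index-injective : Injective _≡_ _≡_ index
  index-injective {x} {y} same = begin
    x                  ≡⟨ to∘to⁻ x ⟨
    element (index x)  ≡⟨ cong element same ⟩
    element (index y)  ≡⟨ to∘to⁻ y ⟩
    y                  ∎
    where
    open ≡-Reasoning
    open Surjection (Bijection.surjection enumeration) using (to∘to⁻)

  _≟F_ : DecidableEquality Carrier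
  x ≟F y = map′ index-injective (cong index) (index x Fin.≟ index y)

module PolynomialRing {q : ℕ} (F : FiniteField q) where
  open FiniteField F renaming (_+_ to _+F_; _*_ to _*F_)
  open Poly F

  private module K = CommutativeRing (Elements.F-commutativeRing F)
  open import Algebra.Properties.Ring K.ring using (-0#≈0#)
  open import Algebra.Properties.CommutativeSemigroup K.+-commutativeSemigroup using (interchange)
  open ≡-Reasoning

  tail : B → B
  tail [] = []
  tail (x ∷ xs) = xs

  coeff-tail : ∀ a i → coeff (tail a) i ≡ coeff a (suc i)
  coeff-tail [] i = refl
  coeff-tail (x ∷ a) i = refl

  coeff-+B : ∀ a b i → coeff (a +B b) i ≡ coeff a i +F coeff b i
  coeff-+B [] b i = sym (K.+-identityˡ _)
  coeff-+B (x ∷ a) [] i = sym (K.+-identityʳ _)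
  coeff-+B (x ∷ a) (y ∷ b) zero = refl
  coeff-+B (x ∷ a) (y ∷ b) (suc i) = coeff-+B a b i

  coeff-scale : ∀ c b i → coeff (List.map (c *F_) b) i ≡ c *F coeff b i
  coeff-scale c [] i = sym (K.zeroʳ c)
  coeff-scale c (x ∷ b) zero = refl
  coeff-scale c (x ∷ b) (suc i) = coeff-scale c b i

  coeff-zero-*B : ∀ a b → coeff (a *B b) 0 ≡ coeff a 0 *F coeff b 0
  coeff-zero-*B [] b = sym (K.zeroˡ _)
  coeff-zero-*B (x ∷ a) b = trans (coeff-+B (List.map (x *F_) b) (0# ∷ (a *B b)) 0)
                        (trans (K.+-identityʳ _) (coeff-scale x b 0))

  coeff-suc-*B : ∀ a b i → coeff (a *B b) (suc i) ≡ coeff a 0 *F coeff b (suc i) +F coeff (tail a *B b) i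
  coeff-suc-*B [] b i = sym (trans (cong (_+F 0#) (K.zeroˡ _)) (K.+-identityˡ _))
  coeff-suc-*B (x ∷ a) b i = trans (coeff-+B (List.map (x *F_) b) (0# ∷ (a *B b)) (suc i))
                          (cong (_+F coeff (a *B b) i) (coeff-scale x b (suc i)))

  -- A record, so that a and b can be inferred from a proof of a ≋ b.
  infix 4 _≋_
  record _≋_ (a b : B) : Set where
    constructor mk≋
    field get : a ≈B b
  open _≋_ public

  ≋-refl : ∀ {a} → a ≋ a
  ≋-refl = mk≋ λ i → refl
  ≋-sym : ∀ {a b} → a ≋ b → b ≋ a
  ≋-sym (mk≋ p) = mk≋ λ i → sym (p i)
  ≋-trans : ∀ {a b c} → a ≋ b → b ≋ c → a ≋ c
  ≋-trans (mk≋ p) (mk≋ r) = mk≋ λ i → trans (p i) (r i)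

  +B-cong : ∀ {a a' b b'} → a ≋ a' → b ≋ b' → (a +B b) ≋ (a' +B b')
  +B-cong {a} {a'} {b} {b'} (mk≋ p) (mk≋ r) = mk≋ λ i → trans (coeff-+B a b i)
      (trans (cong₂ _+F_ (p i) (r i)) (sym (coeff-+B a' b' i)))

  +B-assoc : ∀ a b c → ((a +B b) +B c) ≋ (a +B (b +B c))
  +B-assoc a b c = mk≋ λ i → begin
    coeff ((a +B b) +B c) i ≡⟨ coeff-+B (a +B b) c i ⟩
    coeff (a +B b) i +F coeff c i ≡⟨ cong (_+F coeff c i) (coeff-+B a b i) ⟩
    (coeff a i +F coeff b i) +F coeff c i ≡⟨ K.+-assoc _ _ _ ⟩
    coeff a i +F (coeff b i +F coeff c i) ≡⟨ cong (coeff a i +F_) (sym (coeff-+B b c i)) ⟩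
    coeff a i +F coeff (b +B c) i ≡⟨ sym (coeff-+B a (b +B c) i) ⟩
    coeff (a +B (b +B c)) i ∎

  +B-comm : ∀ a b → (a +B b) ≋ (b +B a)
  +B-comm a b = mk≋ λ i → trans (coeff-+B a b i) (trans (K.+-comm _ _) (sym (coeff-+B b a i)))

  +B-identityˡ : ∀ a → (0B +B a) ≋ a
  +B-identityˡ a = ≋-refl

  +B-identityʳ : ∀ a → (a +B 0B) ≋ a
  +B-identityʳ a = mk≋ λ i → trans (coeff-+B a [] i) (K.+-identityʳ _)

  -B_ : B → B
  -B_ = List.map (-_)

  coeff--B : ∀ a i → coeff (-B a) i ≡ - coeff a i
  coeff--B [] i = sym -0#≈0#
  coeff--B (x ∷ a) zero = refl
  coeff--B (x ∷ a) (suc i) = coeff--B a i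

  -B-cong : ∀ {a b} → a ≋ b → (-B a) ≋ (-B b)
  -B-cong {a} {b} (mk≋ p) = mk≋ λ i → trans (coeff--B a i) (trans (cong -_ (p i)) (sym (coeff--B b i)))

  -B-inverseʳ : ∀ a → (a +B (-B a)) ≋ 0B
  -B-inverseʳ a = mk≋ λ i → trans (coeff-+B a (-B a) i) (trans (cong (coeff a i +F_) (coeff--B a i)) (K.-‿inverseʳ _))

  -B-inverseˡ : ∀ a → ((-B a) +B a) ≋ 0B
  -B-inverseˡ a = ≋-trans (+B-comm (-B a) a) (-B-inverseʳ a)

  tail-cong : ∀ {a b} → a ≋ b → tail a ≋ tail b
  tail-cong {a} {b} (mk≋ p) = mk≋ λ i → trans (coeff-tail a i) (trans (p (suc i)) (sym (coeff-tail b i)))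

  coeff-*B-cong : ∀ n a a' b b' → a ≋ a' → b ≋ b' → coeff (a *B b) n ≡ coeff (a' *B b') n
  coeff-*B-cong zero a a' b b' (mk≋ p) (mk≋ r) = trans (coeff-zero-*B a b)
      (trans (cong₂ _*F_ (p 0) (r 0)) (sym (coeff-zero-*B a' b')))
  coeff-*B-cong (suc n) a a' b b' (mk≋ p) (mk≋ r) =
    trans (coeff-suc-*B a b n) (trans (cong₂ _+F_ (cong₂ _*F_ (p 0) (r (suc n)))
       (coeff-*B-cong n (tail a) (tail a') b b' (tail-cong {a} {a'} (mk≋ p)) (mk≋ r))) (sym (coeff-suc-*B a' b' n)))

  *B-cong : ∀ {a a' b b'} → a ≋ a' → b ≋ b' → (a *B b) ≋ (a' *B b')
  *B-cong {a} {a'} {b} {b'} p r = mk≋ λ n → coeff-*B-cong n a a' b b' p r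

  coeff-suc-*B′ : ∀ n a b → coeff (a *B b) (suc n) ≡ coeff b 0 *F coeff a (suc n) +F coeff (a *B tail b) n
  coeff-suc-*B′ zero a b = begin
    coeff (a *B b) 1
      ≡⟨ coeff-suc-*B a b 0 ⟩
    coeff a 0 *F coeff b 1 +F coeff (tail a *B b) 0
      ≡⟨ cong (coeff a 0 *F coeff b 1 +F_) (coeff-zero-*B (tail a) b) ⟩
    coeff a 0 *F coeff b 1 +F coeff (tail a) 0 *F coeff b 0
      ≡⟨ K.+-comm _ _ ⟩
    coeff (tail a) 0 *F coeff b 0 +F coeff a 0 *F coeff b 1
      ≡⟨ cong₂ _+F_ (trans (K.*-comm _ _) (cong (coeff b 0 *F_) (coeff-tail a 0))) (cong (coeff a 0 *F_) (sym (coeff-tail b 0))) ⟩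
    coeff b 0 *F coeff a 1 +F coeff a 0 *F coeff (tail b) 0
      ≡⟨ cong (coeff b 0 *F coeff a 1 +F_) (sym (coeff-zero-*B a (tail b))) ⟩
    coeff b 0 *F coeff a 1 +F coeff (a *B tail b) 0 ∎
  coeff-suc-*B′ (suc n) a b = begin
    coeff (a *B b) (suc (suc n))
      ≡⟨ coeff-suc-*B a b (suc n) ⟩
    coeff a 0 *F coeff b (suc (suc n)) +F coeff (tail a *B b) (suc n)
      ≡⟨ cong (coeff a 0 *F coeff b (suc (suc n)) +F_) (coeff-suc-*B′ n (tail a) b) ⟩
    coeff a 0 *F coeff b (suc (suc n)) +F (coeff b 0 *F coeff (tail a) (suc n) +F coeff (tail a *B tail b) n)
      ≡⟨ sym (K.+-assoc _ _ _) ⟩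
    (coeff a 0 *F coeff b (suc (suc n)) +F coeff b 0 *F coeff (tail a) (suc n)) +F coeff (tail a *B tail b) n
      ≡⟨ cong (_+F coeff (tail a *B tail b) n) (K.+-comm _ _) ⟩
    (coeff b 0 *F coeff (tail a) (suc n) +F coeff a 0 *F coeff b (suc (suc n))) +F coeff (tail a *B tail b) n
      ≡⟨ K.+-assoc _ _ _ ⟩
    coeff b 0 *F coeff (tail a) (suc n) +F (coeff a 0 *F coeff b (suc (suc n)) +F coeff (tail a *B tail b) n)
      ≡⟨ cong₂ _+F_ (cong (coeff b 0 *F_) (coeff-tail a (suc n))) (cong₂ _+F_ (cong (coeff a 0 *F_) (sym (coeff-tail b (suc n)))) refl) ⟩
    coeff b 0 *F coeff a (suc (suc n)) +F (coeff a 0 *F coeff (tail b) (suc n) +F coeff (tail a *B tail b) n)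
      ≡⟨ cong (coeff b 0 *F coeff a (suc (suc n)) +F_) (sym (coeff-suc-*B a (tail b) n)) ⟩
    coeff b 0 *F coeff a (suc (suc n)) +F coeff (a *B tail b) (suc n) ∎

  coeff-*B-comm : ∀ n a b → coeff (a *B b) n ≡ coeff (b *B a) n
  coeff-*B-comm zero a b = trans (coeff-zero-*B a b) (trans (K.*-comm _ _) (sym (coeff-zero-*B b a)))
  coeff-*B-comm (suc n) a b = trans (coeff-suc-*B′ n a b)
      (trans (cong (coeff b 0 *F coeff a (suc n) +F_) (coeff-*B-comm n a (tail b))) (sym (coeff-suc-*B b a n)))

  *B-comm : ∀ a b → (a *B b) ≋ (b *B a)
  *B-comm a b = mk≋ λ n → coeff-*B-comm n a b

  coeff-*B-distribˡ : ∀ n a b c → coeff (a *B (b +B c)) n ≡ coeff (a *B b) n +F coeff (a *B c) n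
  coeff-*B-distribˡ zero a b c = begin
    coeff (a *B (b +B c)) 0
      ≡⟨ coeff-zero-*B a (b +B c) ⟩
    coeff a 0 *F coeff (b +B c) 0
      ≡⟨ cong (coeff a 0 *F_) (coeff-+B b c 0) ⟩
    coeff a 0 *F (coeff b 0 +F coeff c 0)
      ≡⟨ K.distribˡ _ _ _ ⟩
    coeff a 0 *F coeff b 0 +F coeff a 0 *F coeff c 0
      ≡⟨ sym (cong₂ _+F_ (coeff-zero-*B a b) (coeff-zero-*B a c)) ⟩
    coeff (a *B b) 0 +F coeff (a *B c) 0 ∎
  coeff-*B-distribˡ (suc n) a b c = begin
    coeff (a *B (b +B c)) (suc n)
      ≡⟨ coeff-suc-*B a (b +B c) n ⟩
    coeff a 0 *F coeff (b +B c) (suc n) +F coeff (tail a *B (b +B c)) n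
      ≡⟨ cong₂ _+F_ (trans (cong (coeff a 0 *F_) (coeff-+B b c (suc n))) (K.distribˡ _ _ _)) (coeff-*B-distribˡ n (tail a) b c) ⟩
    (coeff a 0 *F coeff b (suc n) +F coeff a 0 *F coeff c (suc n)) +F (coeff (tail a *B b) n +F coeff (tail a *B c) n)
      ≡⟨ interchange _ _ _ _ ⟩
    (coeff a 0 *F coeff b (suc n) +F coeff (tail a *B b) n) +F (coeff a 0 *F coeff c (suc n) +F coeff (tail a *B c) n)
      ≡⟨ sym (cong₂ _+F_ (coeff-suc-*B a b n) (coeff-suc-*B a c n)) ⟩
    coeff (a *B b) (suc n) +F coeff (a *B c) (suc n) ∎

  *B-distribˡ : ∀ a b c → (a *B (b +B c)) ≋ ((a *B b) +B (a *B c))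
  *B-distribˡ a b c = mk≋ λ n → trans (coeff-*B-distribˡ n a b c) (sym (coeff-+B (a *B b) (a *B c) n))

  *B-distribʳ : ∀ a b c → ((b +B c) *B a) ≋ ((b *B a) +B (c *B a))
  *B-distribʳ a b c = ≋-trans (*B-comm (b +B c) a) (≋-trans (*B-distribˡ a b c) (+B-cong (*B-comm a b) (*B-comm a c)))

  scale : Carrier → B → B
  scale c b = List.map (c *F_) b

  coeff-scale-*B : ∀ n k a b → coeff (scale k a *B b) n ≡ k *F coeff (a *B b) n
  coeff-scale-*B zero k a b = begin
    coeff (scale k a *B b) 0 ≡⟨ coeff-zero-*B (scale k a) b ⟩
    coeff (scale k a) 0 *F coeff b 0 ≡⟨ cong (_*F coeff b 0) (coeff-scale k a 0) ⟩
    (k *F coeff a 0) *F coeff b 0 ≡⟨ K.*-assoc _ _ _ ⟩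
    k *F (coeff a 0 *F coeff b 0) ≡⟨ cong (k *F_) (sym (coeff-zero-*B a b)) ⟩
    k *F coeff (a *B b) 0 ∎
  coeff-scale-*B (suc n) k a b = begin
    coeff (scale k a *B b) (suc n)
      ≡⟨ coeff-suc-*B (scale k a) b n ⟩
    coeff (scale k a) 0 *F coeff b (suc n) +F coeff (tail (scale k a) *B b) n
      ≡⟨ cong₂ _+F_ (trans (cong (_*F coeff b (suc n)) (coeff-scale k a 0)) (K.*-assoc _ _ _)) (trans (coeff-*B-cong n (tail (scale k a)) (scale k (tail a)) b b tail-scale ≋-refl) (coeff-scale-*B n k (tail a) b)) ⟩
    k *F (coeff a 0 *F coeff b (suc n)) +F k *F coeff (tail a *B b) n
      ≡⟨ sym (K.distribˡ _ _ _) ⟩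
    k *F (coeff a 0 *F coeff b (suc n) +F coeff (tail a *B b) n)
      ≡⟨ cong (k *F_) (sym (coeff-suc-*B a b n)) ⟩
    k *F coeff (a *B b) (suc n) ∎
    where
    tail-scale : tail (scale k a) ≋ scale k (tail a)
    tail-scale = mk≋ λ i → trans (coeff-tail (scale k a) i)
        (trans (coeff-scale k a (suc i)) (trans (cong (k *F_) (sym (coeff-tail a i))) (sym (coeff-scale k (tail a) i))))

  tail-*B : ∀ a b → tail (a *B b) ≋ (scale (coeff a 0) (tail b) +B (tail a *B b))
  tail-*B a b = mk≋ λ i → begin
    coeff (tail (a *B b)) i
      ≡⟨ coeff-tail (a *B b) i ⟩
    coeff (a *B b) (suc i)
      ≡⟨ coeff-suc-*B a b i ⟩
    coeff a 0 *F coeff b (suc i) +F coeff (tail a *B b) i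
      ≡⟨ cong (_+F coeff (tail a *B b) i) (trans (cong (coeff a 0 *F_) (sym (coeff-tail b i))) (sym (coeff-scale (coeff a 0) (tail b) i))) ⟩
    coeff (scale (coeff a 0) (tail b)) i +F coeff (tail a *B b) i
      ≡⟨ sym (coeff-+B (scale (coeff a 0) (tail b)) (tail a *B b) i) ⟩
    coeff (scale (coeff a 0) (tail b) +B (tail a *B b)) i ∎

  coeff-*B-assoc : ∀ n a b c → coeff ((a *B b) *B c) n ≡ coeff (a *B (b *B c)) n
  coeff-*B-assoc zero a b c = begin
    coeff ((a *B b) *B c) 0 ≡⟨ coeff-zero-*B (a *B b) c ⟩
    coeff (a *B b) 0 *F coeff c 0 ≡⟨ cong (_*F coeff c 0) (coeff-zero-*B a b) ⟩
    (coeff a 0 *F coeff b 0) *F coeff c 0 ≡⟨ K.*-assoc _ _ _ ⟩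
    coeff a 0 *F (coeff b 0 *F coeff c 0) ≡⟨ cong (coeff a 0 *F_) (sym (coeff-zero-*B b c)) ⟩
    coeff a 0 *F coeff (b *B c) 0 ≡⟨ sym (coeff-zero-*B a (b *B c)) ⟩
    coeff (a *B (b *B c)) 0 ∎
  coeff-*B-assoc (suc n) a b c = begin
    coeff ((a *B b) *B c) (suc n) ≡⟨ coeff-suc-*B (a *B b) c n ⟩
    coeff (a *B b) 0 *F coeff c (suc n) +F coeff (tail (a *B b) *B c) n
      ≡⟨ cong₂ _+F_ (trans (cong (_*F coeff c (suc n)) (coeff-zero-*B a b)) (K.*-assoc _ _ _))
          (coeff-*B-cong n (tail (a *B b)) _ c c (tail-*B a b) ≋-refl) ⟩
    coeff a 0 *F (coeff b 0 *F coeff c (suc n)) +F coeff ((scale (coeff a 0) (tail b) +B (tail a *B b)) *B c) n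
      ≡⟨ cong (coeff a 0 *F (coeff b 0 *F coeff c (suc n)) +F_) (trans (get (*B-distribʳ c (scale (coeff a 0) (tail b)) (tail a *B b)) n) (coeff-+B (scale (coeff a 0) (tail b) *B c) ((tail a *B b) *B c) n)) ⟩
    coeff a 0 *F (coeff b 0 *F coeff c (suc n)) +F
        (coeff (scale (coeff a 0) (tail b) *B c) n +F coeff ((tail a *B b) *B c) n)
      ≡⟨ cong (coeff a 0 *F (coeff b 0 *F coeff c (suc n)) +F_) (cong₂ _+F_ (coeff-scale-*B n (coeff a 0) (tail b) c) (coeff-*B-assoc n (tail a) b c)) ⟩
    coeff a 0 *F (coeff b 0 *F coeff c (suc n)) +F (coeff a 0 *F coeff (tail b *B c) n +F coeff (tail a *B (b *B c)) n)
      ≡⟨ sym (K.+-assoc _ _ _) ⟩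
    (coeff a 0 *F (coeff b 0 *F coeff c (suc n)) +F coeff a 0 *F coeff (tail b *B c) n) +F coeff (tail a *B (b *B c)) n
      ≡⟨ cong (_+F coeff (tail a *B (b *B c)) n) (trans (sym (K.distribˡ _ _ _)) (cong (coeff a 0 *F_) (sym (coeff-suc-*B b c n)))) ⟩
    coeff a 0 *F coeff (b *B c) (suc n) +F coeff (tail a *B (b *B c)) n ≡⟨ sym (coeff-suc-*B a (b *B c) n) ⟩
    coeff (a *B (b *B c)) (suc n) ∎

  *B-assoc : ∀ a b c → ((a *B b) *B c) ≋ (a *B (b *B c))
  *B-assoc a b c = mk≋ λ n → coeff-*B-assoc n a b c

  *B-identityˡ : ∀ a → (1B *B a) ≋ a
  *B-identityˡ a = mk≋ coeff-1B-*B
    where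
    coeff-1B-*B : (1B *B a) ≈B a
    coeff-1B-*B zero    = trans (coeff-zero-*B 1B a) (K.*-identityˡ _)
    coeff-1B-*B (suc n) = trans (coeff-suc-*B 1B a n) (trans (cong₂ _+F_ (K.*-identityˡ _) refl) (K.+-identityʳ _))

  *B-identityʳ : ∀ a → (a *B 1B) ≋ a
  *B-identityʳ a = ≋-trans (*B-comm a 1B) (*B-identityˡ a)

  *B-zeroˡ : ∀ a → (0B *B a) ≋ 0B
  *B-zeroˡ a = ≋-refl

  *B-zeroʳ : ∀ a → (a *B 0B) ≋ 0B
  *B-zeroʳ a = ≋-trans (*B-comm a 0B) (*B-zeroˡ a)

  _-B_ : B → B → B
  a -B b = a +B (-B b)

  ≋-isEquivalence : IsEquivalence _≋_
  ≋-isEquivalence = record { refl = ≋-refl ; sym = ≋-sym ; trans = ≋-trans }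

  B-setoid : Setoid _ _
  B-setoid = record { Carrier = B ; _≈_ = _≋_ ; isEquivalence = ≋-isEquivalence }

  B-commutativeRing : CommutativeRing _ _
  B-commutativeRing = record
    { Carrier = B ; _≈_ = _≋_ ; _+_ = _+B_ ; _*_ = _*B_ ; -_ = -B_ ; 0# = 0B ; 1# = 1B
    ; isCommutativeRing = record
      { isRing = record
        { +-isAbelianGroup = record
          { isGroup = record
            { isMonoid = record
              { isSemigroup = record
                { isMagma = record { isEquivalence = ≋-isEquivalence ; ∙-cong = +B-cong }
                ; assoc = +B-assoc }
              ; identity = +B-identityˡ , +B-identityʳ }
            ; inverse = -B-inverseˡ , -B-inverseʳ
            ; ⁻¹-cong = -B-cong }
          ; comm = +B-comm }
        ; *-cong = *B-cong
        ; *-assoc = *B-assoc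
        ; *-identity = *B-identityˡ , *B-identityʳ
        ; distrib = (λ a b c → *B-distribˡ a b c) , (λ a b c → *B-distribʳ a b c) }
      ; *-comm = *B-comm } }

  private
    B-almostCommutativeRing : AlmostCommutativeRing _ _
    B-almostCommutativeRing = fromCommutativeRing B-commutativeRing (λ _ → nothing)

  open import Tactic.RingSolver.NonReflective B-almostCommutativeRing public using (solve; _⊜_; _⊕_; _⊗_)

module XAdic {q : ℕ} (F : FiniteField q) where
  open FiniteField F renaming (_+_ to _+F_; _*_ to _*F_)
  open Poly F
  open PolynomialRing F
  open Elements F using (_≟F_; F-commutativeRing)
  open ≡-Reasoning
  private module K = CommutativeRing F-commutativeRing
  open import Algebra.Properties.Ring K.ring using (-0#≈0#)

  infix 4 X^_∣_
  X^_∣_ : ℕ → B → Set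
  X^ m ∣ b = ∀ i → i < m → coeff b i ≡ 0#

  X^∣-resp-≋ : ∀ {a b m} → a ≋ b → X^ m ∣ a → X^ m ∣ b
  X^∣-resp-≋ (mk≋ p) h i i<m = trans (sym (p i)) (h i i<m)

  X^∣-weaken : ∀ {b m m'} → m' ≤ m → X^ m ∣ b → X^ m' ∣ b
  X^∣-weaken m'≤m h i i<m' = h i (<-≤-trans i<m' m'≤m)

  X^∣-+B : ∀ {a b m} → X^ m ∣ a → X^ m ∣ b → X^ m ∣ (a +B b)
  X^∣-+B {a} {b} ha hb i i<m = trans (coeff-+B a b i) (trans (cong₂ _+F_ (ha i i<m) (hb i i<m)) (K.+-identityˡ 0#))

  X^∣-negate : ∀ {a m} → X^ m ∣ a → X^ m ∣ (-B a)
  X^∣-negate {a} ha i i<m = trans (coeff--B a i) (trans (cong -_ (ha i i<m)) -0#≈0#)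

  X^∣--B : ∀ {a b m} → X^ m ∣ a → X^ m ∣ b → X^ m ∣ (a -B b)
  X^∣--B {a} {b} ha hb = X^∣-+B {a} { -B b} ha (X^∣-negate {b} hb)

  coeff-Xpow-*B-low : ∀ m g i → i < m → coeff (Xpow m *B g) i ≡ 0#
  coeff-Xpow-*B-low (suc m) g zero _ = trans (coeff-zero-*B (Xpow (suc m)) g) (K.zeroˡ _)
  coeff-Xpow-*B-low (suc m) g (suc i) (s≤s i<m) =
    trans (coeff-suc-*B (Xpow (suc m)) g i) (trans (cong₂ _+F_ (K.zeroˡ _) (coeff-Xpow-*B-low m g i i<m)) (K.+-identityˡ 0#))

  coeff-Xpow-*B-high : ∀ m g i → coeff (Xpow m *B g) (m + i) ≡ coeff g i
  coeff-Xpow-*B-high zero g i = get (*B-identityˡ g) i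
  coeff-Xpow-*B-high (suc m) g i =
    trans (coeff-suc-*B (Xpow (suc m)) g (m + i))
        (trans (cong₂ _+F_ (K.zeroˡ _) (coeff-Xpow-*B-high m g i)) (K.+-identityˡ _))

  XPowDivides⇒X^∣ : ∀ {m b} → XPowDivides m b → X^ m ∣ b
  XPowDivides⇒X^∣ {m} {b} (g , p) i i<m = trans (p i) (coeff-Xpow-*B-low m g i i<m)

  coeff-drop : ∀ m b i → coeff (List.drop m b) i ≡ coeff b (m + i)
  coeff-drop zero b i = refl
  coeff-drop (suc m) [] i = refl
  coeff-drop (suc m) (x ∷ b) i = coeff-drop m b i

  X^∣⇒factor : ∀ m b → X^ m ∣ b → b ≈B (Xpow m *B List.drop m b)
  X^∣⇒factor zero b h i = sym (get (*B-identityˡ b) i)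
  X^∣⇒factor (suc m) b h zero = trans (h 0 (s≤s z≤n))
      (sym (trans (coeff-zero-*B (Xpow (suc m)) (List.drop (suc m) b)) (K.zeroˡ _)))
  X^∣⇒factor (suc m) b h (suc i) = begin
      coeff b (suc i)
        ≡⟨ sym (coeff-tail b i) ⟩
      coeff (tail b) i
        ≡⟨ X^∣⇒factor m (tail b) (λ j j<m → trans (coeff-tail b j) (h (suc j) (s≤s j<m))) i ⟩
      coeff (Xpow m *B List.drop m (tail b)) i
        ≡⟨ cong (λ z → coeff (Xpow m *B z) i) (drop-tail b) ⟩
      coeff (Xpow m *B List.drop (suc m) b) i
        ≡⟨ sym (trans (coeff-suc-*B (Xpow (suc m)) _ i) (trans (cong₂ _+F_ (K.zeroˡ _) refl) (K.+-identityˡ _))) ⟩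
      coeff (Xpow (suc m) *B List.drop (suc m) b) (suc i) ∎
    where
    drop-tail : ∀ b → List.drop m (tail b) ≡ List.drop (suc m) b
    drop-tail []      = List.drop-[] m
    drop-tail (x ∷ b) = refl

  X^∣⇒XPowDivides : ∀ {m b} → X^ m ∣ b → XPowDivides m b
  X^∣⇒XPowDivides {m} {b} h = List.drop m b , X^∣⇒factor m b h

  X^∣-cancel-unit : ∀ m u Q → coeff u 0 ≢ 0# → X^ m ∣ (u *B Q) → X^ m ∣ Q
  X^∣-cancel-unit (suc m) u Q u0 h zero _ = Q0
    where
    Q0 : coeff Q 0 ≡ 0#
    Q0 with inverse (coeff u 0) u0
    ... | w , uw = begin
      coeff Q 0 ≡⟨ sym (K.*-identityˡ _) ⟩
      1# *F coeff Q 0 ≡⟨ cong (_*F coeff Q 0) (sym uw) ⟩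
      (coeff u 0 *F w) *F coeff Q 0 ≡⟨ cong (_*F coeff Q 0) (K.*-comm _ _) ⟩
      (w *F coeff u 0) *F coeff Q 0 ≡⟨ K.*-assoc _ _ _ ⟩
      w *F (coeff u 0 *F coeff Q 0) ≡⟨ cong (w *F_) (sym (coeff-zero-*B u Q)) ⟩
      w *F coeff (u *B Q) 0 ≡⟨ cong (w *F_) (h 0 (s≤s z≤n)) ⟩
      w *F 0# ≡⟨ K.zeroʳ _ ⟩
      0# ∎
  X^∣-cancel-unit (suc m) u Q u0 h (suc i) (s≤s i<m) =
    trans (sym (coeff-tail Q i)) (X^∣-cancel-unit m u (tail Q) u0 htl i i<m)
    where
    Q0 : coeff Q 0 ≡ 0#
    Q0 = X^∣-cancel-unit (suc m) u Q u0 h 0 (s≤s z≤n)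
    htl : X^ m ∣ (u *B tail Q)
    htl j j<m = begin
      coeff (u *B tail Q) j
        ≡⟨ coeff-*B-comm j u (tail Q) ⟩
      coeff (tail Q *B u) j
        ≡⟨ sym (K.+-identityˡ _) ⟩
      0# +F coeff (tail Q *B u) j
        ≡⟨ cong (_+F coeff (tail Q *B u) j) (sym (trans (cong (_*F coeff u (suc j)) Q0) (K.zeroˡ _))) ⟩
      coeff Q 0 *F coeff u (suc j) +F coeff (tail Q *B u) j
        ≡⟨ sym (coeff-suc-*B Q u j) ⟩
      coeff (Q *B u) (suc j)
        ≡⟨ coeff-*B-comm (suc j) Q u ⟩
      coeff (u *B Q) (suc j)
        ≡⟨ h (suc j) (s≤s j<m) ⟩
      0# ∎

  X^∣-cancel-Xpow : ∀ e m w → X^ (e + m) ∣ (Xpow e *B w) → X^ m ∣ w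
  X^∣-cancel-Xpow e m w h i i<m = trans (sym (coeff-Xpow-*B-high e w i)) (h (e + i) (+-monoʳ-< e i<m))

  lowestNonzeroCoeff : ∀ e D → coeff D e ≢ 0# → Σ ℕ λ v → v ≤ e × X^ v ∣ D × coeff D v ≢ 0#
  lowestNonzeroCoeff e D Dₑ≢0 with coeff D 0 ≟F 0#
  lowestNonzeroCoeff e       D Dₑ≢0 | no  D₀≢0 = 0 , z≤n , (λ i ()) , D₀≢0
  lowestNonzeroCoeff zero    D Dₑ≢0 | yes D₀≡0 = ⊥-elim (Dₑ≢0 D₀≡0)
  lowestNonzeroCoeff (suc e) D Dₑ≢0 | yes D₀≡0
    with lowestNonzeroCoeff e (tail D) (λ tailₑ≡0 → Dₑ≢0 (trans (sym (coeff-tail D e)) tailₑ≡0))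
  ... | v , v≤e , X^v∣tail , tailᵥ≢0 = suc v , s≤s v≤e , X^v+1∣D , (λ Dᵥ₊₁≡0 → tailᵥ≢0 (trans (coeff-tail D v) Dᵥ₊₁≡0))
    where
    X^v+1∣D : X^ (suc v) ∣ D
    X^v+1∣D zero    _         = D₀≡0
    X^v+1∣D (suc i) (s≤s i<v) = trans (sym (coeff-tail D i)) (X^v∣tail i i<v)

  ValXAtMost : B → ℕ → Set
  ValXAtMost b e = Σ ℕ λ i → i ≤ e × coeff b i ≢ 0#

  X^∣-cancel : ∀ {D Q e m} → ValXAtMost D e → X^ (e + m) ∣ (D *B Q) → X^ m ∣ Q
  X^∣-cancel {D} {Q} {e} {m} (i , i≤e , Dᵢ≢0) X^∣DQ with lowestNonzeroCoeff i D Dᵢ≢0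
  ... | v , v≤i , X^v∣D , Dᵥ≢0 = X^∣-cancel-unit m u Q u₀≢0 (X^∣-cancel-Xpow v m (u *B Q) X^∣XᵛuQ)
    where
    u : B
    u = List.drop v D
    u₀≢0 : coeff u 0 ≢ 0#
    u₀≢0 u₀≡0 = Dᵥ≢0 (trans (trans (cong (coeff D) (sym (+-identityʳ v))) (sym (coeff-drop v D 0))) u₀≡0)
    DQ≋XᵛuQ : (D *B Q) ≋ (Xpow v *B (u *B Q))
    DQ≋XᵛuQ = ≋-trans (*B-cong {D} {Xpow v *B u} (mk≋ (X^∣⇒factor v D X^v∣D)) (≋-refl {Q})) (*B-assoc (Xpow v) u Q)
    X^∣XᵛuQ : X^ (v + m) ∣ (Xpow v *B (u *B Q))
    X^∣XᵛuQ = X^∣-resp-≋ {D *B Q} DQ≋XᵛuQ (X^∣-weaken {D *B Q} (+-monoˡ-≤ m (≤-trans v≤i i≤e)) X^∣DQ)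

module DividedDifferences {q : ℕ} (F : FiniteField q) where
  open Poly F
  open PolynomialRing F
  open XAdic F
  open SetoidReasoning B-setoid

  -- The solver cannot cancel s against -B s (B has no decidable zero test), so such
  -- cancellations go through the next three lemmas.
  [x-x]*y≋0 : ∀ x y → ((x -B x) *B y) ≋ 0B
  [x-x]*y≋0 x y = ≋-trans (*B-cong (-B-inverseʳ x) (≋-refl {y})) (*B-zeroˡ y)

  a≋b+d⇒a-b≋d : ∀ a b d → a ≋ (b +B d) → (a -B b) ≋ d
  a≋b+d⇒a-b≋d a b d a≋b+d = begin
    a +B (-B b)         ≈⟨ +B-cong a≋b+d (≋-refl { -B b}) ⟩
    (b +B d) +B (-B b)  ≈⟨ solve 3 (λ b d nb → ((b ⊕ d) ⊕ nb) ⊜ (d ⊕ (b ⊕ nb))) ≋-refl b d (-B b) ⟩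
    d +B (b +B (-B b))  ≈⟨ +B-cong (≋-refl {d}) (-B-inverseʳ b) ⟩
    d +B 0B             ≈⟨ +B-identityʳ d ⟩
    d                   ∎

  a-b≋d⇒a≋b+d : ∀ a b d → (a -B b) ≋ d → a ≋ (b +B d)
  a-b≋d⇒a≋b+d a b d a-b≋d = begin
    a                   ≈⟨ ≋-sym (+B-identityʳ a) ⟩
    a +B 0B             ≈⟨ +B-cong (≋-refl {a}) (≋-sym (-B-inverseˡ b)) ⟩
    a +B ((-B b) +B b)  ≈⟨ solve 3 (λ a b nb → (a ⊕ (nb ⊕ b)) ⊜ (b ⊕ (a ⊕ nb))) ≋-refl a b (-B b) ⟩
    b +B (a -B b)       ≈⟨ +B-cong (≋-refl {b}) a-b≋d ⟩
    b +B d              ∎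

  -- c₀ ∷ c₁ ∷ … ∷ c_d represents c₀ + c₁ x + … + c_d x^d.
  horner : ∀ {d} → Vec B (suc d) → B → B
  horner {zero}  (c ∷ []) x = c
  horner {suc d} (c ∷ cs) x = c +B (x *B horner cs x)

  leading : ∀ {d} → Vec B (suc d) → B
  leading {zero}  (c ∷ []) = c
  leading {suc d} (c ∷ cs) = leading cs

  addLower : ∀ {m} → Vec B (suc m) → Vec B m → Vec B (suc m)
  addLower {zero}  (c ∷ []) []       = c ∷ []
  addLower {suc m} (c ∷ cs) (e ∷ es) = (c +B e) ∷ addLower cs es

  -- The coefficients of (p(x) − p(s)) / (x − s), by synthetic division.
  divideAt : ∀ {d} → Vec B (suc (suc d)) → B → Vec B (suc d)
  divideAt {zero}  (c ∷ c′ ∷ []) s = c′ ∷ []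
  divideAt {suc d} (c ∷ cs)      s = addLower cs (Vec.map (s *B_) (divideAt cs s))

  leading-addLower : ∀ {m} (u : Vec B (suc m)) w → leading (addLower u w) ≡ leading u
  leading-addLower {zero}  (c ∷ []) []       = refl
  leading-addLower {suc m} (c ∷ cs) (e ∷ es) = leading-addLower cs es

  leading-divideAt : ∀ {d} (p : Vec B (suc (suc d))) s → leading (divideAt p s) ≡ leading p
  leading-divideAt {zero}  (c ∷ c′ ∷ []) s = refl
  leading-divideAt {suc d} (c ∷ cs)      s = leading-addLower cs _

  horner-addLower : ∀ {m} (u : Vec B (suc (suc m))) (w : Vec B (suc m)) x →
                    horner (addLower u w) x ≋ (horner u x +B horner w x)
  horner-addLower {zero} (c ∷ c′ ∷ []) (e ∷ []) x =
    solve 4 (λ c c′ e x → ((c ⊕ e) ⊕ (x ⊗ c′)) ⊜ ((c ⊕ (x ⊗ c′)) ⊕ e)) ≋-refl c c′ e x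
  horner-addLower {suc m} (c ∷ u) (e ∷ w) x = begin
    (c +B e) +B (x *B horner (addLower u w) x)
      ≈⟨ +B-cong (≋-refl {c +B e}) (*B-cong (≋-refl {x}) (horner-addLower u w x)) ⟩
    (c +B e) +B (x *B (horner u x +B horner w x))
      ≈⟨ solve 5 (λ c e x U W → ((c ⊕ e) ⊕ (x ⊗ (U ⊕ W))) ⊜ ((c ⊕ (x ⊗ U)) ⊕ (e ⊕ (x ⊗ W))))
                 ≋-refl c e x (horner u x) (horner w x) ⟩
    (c +B (x *B horner u x)) +B (e +B (x *B horner w x)) ∎

  horner-scale : ∀ {m} (w : Vec B (suc m)) s x → horner (Vec.map (s *B_) w) x ≋ (s *B horner w x)
  horner-scale {zero}  (c ∷ []) s x = ≋-refl
  horner-scale {suc m} (c ∷ w)  s x = begin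
    (s *B c) +B (x *B horner (Vec.map (s *B_) w) x)
      ≈⟨ +B-cong (≋-refl {s *B c}) (*B-cong (≋-refl {x}) (horner-scale w s x)) ⟩
    (s *B c) +B (x *B (s *B horner w x))
      ≈⟨ solve 4 (λ s c x W → ((s ⊗ c) ⊕ (x ⊗ (s ⊗ W))) ⊜ (s ⊗ (c ⊕ (x ⊗ W)))) ≋-refl s c x (horner w x) ⟩
    s *B (c +B (x *B horner w x)) ∎

  horner-divideAt : ∀ {d} (p : Vec B (suc (suc d))) s x →
                    (horner p x -B horner p s) ≋ ((x -B s) *B horner (divideAt p s) x)
  horner-divideAt {zero} (c ∷ c′ ∷ []) s x = a≋b+d⇒a-b≋d _ _ _ (≋-sym (begin
    (c +B (s *B c′)) +B ((x -B s) *B c′)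
      ≈⟨ solve 5 (λ c c′ s ns x → ((c ⊕ (s ⊗ c′)) ⊕ ((x ⊕ ns) ⊗ c′)) ⊜ ((c ⊕ (x ⊗ c′)) ⊕ ((s ⊕ ns) ⊗ c′)))
                 ≋-refl c c′ s (-B s) x ⟩
    (c +B (x *B c′)) +B ((s -B s) *B c′) ≈⟨ +B-cong (≋-refl {c +B (x *B c′)}) ([x-x]*y≋0 s c′) ⟩
    (c +B (x *B c′)) +B 0B                ≈⟨ +B-identityʳ _ ⟩
    c +B (x *B c′)                        ∎))
  horner-divideAt {suc d} (c ∷ cs) s x = a≋b+d⇒a-b≋d _ _ _ (≋-sym (begin
    (c +B (s *B A′)) +B ((x -B s) *B horner (divideAt (c ∷ cs) s) x)
      ≈⟨ +B-cong (≋-refl {c +B (s *B A′)}) (*B-cong (≋-refl {x -B s})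
           (≋-trans (horner-addLower cs (Vec.map (s *B_) (divideAt cs s)) x)
                    (+B-cong A≋A′+[x-s]Q (horner-scale (divideAt cs s) s x)))) ⟩
    (c +B (s *B A′)) +B ((x -B s) *B ((A′ +B ((x -B s) *B Q)) +B (s *B Q)))
      ≈⟨ solve 6 (λ c s ns x A′ Q → ((c ⊕ (s ⊗ A′)) ⊕ ((x ⊕ ns) ⊗ ((A′ ⊕ ((x ⊕ ns) ⊗ Q)) ⊕ (s ⊗ Q))))
                   ⊜ ((c ⊕ (x ⊗ (A′ ⊕ ((x ⊕ ns) ⊗ Q)))) ⊕ ((s ⊕ ns) ⊗ (A′ ⊕ ((x ⊕ ns) ⊗ Q)))))
                 ≋-refl c s (-B s) x A′ Q ⟩
    (c +B (x *B (A′ +B ((x -B s) *B Q)))) +B ((s -B s) *B (A′ +B ((x -B s) *B Q)))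
      ≈⟨ +B-cong (≋-refl {c +B (x *B (A′ +B ((x -B s) *B Q)))}) ([x-x]*y≋0 s _) ⟩
    (c +B (x *B (A′ +B ((x -B s) *B Q)))) +B 0B
      ≈⟨ +B-identityʳ _ ⟩
    c +B (x *B (A′ +B ((x -B s) *B Q)))
      ≈⟨ +B-cong (≋-refl {c}) (*B-cong (≋-refl {x}) (≋-sym A≋A′+[x-s]Q)) ⟩
    c +B (x *B A) ∎))
    where
    A A′ Q : B
    A  = horner cs x
    A′ = horner cs s
    Q  = horner (divideAt cs s) x
    A≋A′+[x-s]Q : A ≋ (A′ +B ((x -B s) *B Q))
    A≋A′+[x-s]Q = a-b≋d⇒a≋b+d A A′ _ (horner-divideAt cs s x)

  -- Dividing p by x − σ₀ keeps the leading coefficient and costs at most e i 0 in the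
  -- X-adic valuation of the value at σᵢ; the potentials β absorb these losses.
  X^∣-leading : ∀ d (p : Vec B (suc d)) (σ : ℕ → B) (e β : ℕ → ℕ → ℕ) T →
    (∀ l i → l < i → i ≤ d → ValXAtMost (σ i -B σ l) (e i l)) →
    (∀ j i → j < i → i ≤ d → (β (suc j) i + e i j ≤ β j i) × (β (suc j) i + e i j ≤ β j j)) →
    (∀ i → i ≤ d → X^ (T + β 0 i) ∣ horner p (σ i)) →
    X^ (T + β d d) ∣ leading p
  X^∣-leading zero    (c ∷ []) σ e β T separated potentials X^∣values = X^∣values 0 z≤n
  X^∣-leading (suc d) p        σ e β T separated potentials X^∣values =
    subst (λ b → X^ (T + β (suc d) (suc d)) ∣ b) (leading-divideAt p (σ 0))
      (X^∣-leading d (divideAt p (σ 0)) (λ i → σ (suc i)) (λ i l → e (suc i) (suc l)) (λ j i → β (suc j) (suc i)) T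
        (λ l i l<i i≤d → separated (suc l) (suc i) (s≤s l<i) (s≤s i≤d))
        (λ j i j<i i≤d → potentials (suc j) (suc i) (s≤s j<i) (s≤s i≤d))
        X^∣quotient)
    where
    X^∣quotient : ∀ i → i ≤ d → X^ (T + β 1 (suc i)) ∣ horner (divideAt p (σ 0)) (σ (suc i))
    X^∣quotient i i≤d = X^∣-cancel {σ (suc i) -B σ 0} (separated 0 (suc i) (s≤s z≤n) (s≤s i≤d)) X^∣product
      where
      M : ℕ
      M = e (suc i) 0 + (T + β 1 (suc i))
      budget : (β 1 (suc i) + e (suc i) 0 ≤ β 0 (suc i)) × (β 1 (suc i) + e (suc i) 0 ≤ β 0 0)
      budget = potentials 0 (suc i) (s≤s z≤n) (s≤s i≤d)
      M≤ : ∀ j → β 1 (suc i) + e (suc i) 0 ≤ β 0 j → M ≤ T + β 0 j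
      M≤ j le = ≤-trans (≤-reflexive (trans (+-comm (e (suc i) 0) _) (+-assoc T _ _))) (+-monoʳ-≤ T le)
      X^∣difference : X^ M ∣ (horner p (σ (suc i)) -B horner p (σ 0))
      X^∣difference = X^∣--B {horner p (σ (suc i))} {horner p (σ 0)}
        (X^∣-weaken {horner p (σ (suc i))} (M≤ (suc i) (proj₁ budget)) (X^∣values (suc i) (s≤s i≤d)))
        (X^∣-weaken {horner p (σ 0)} (M≤ 0 (proj₂ budget)) (X^∣values 0 z≤n))
      X^∣product : X^ M ∣ ((σ (suc i) -B σ 0) *B horner (divideAt p (σ 0)) (σ (suc i)))
      X^∣product = X^∣-resp-≋ {horner p (σ (suc i)) -B horner p (σ 0)} (horner-divideAt p (σ 0) (σ (suc i))) X^∣difference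

module CodesOfCⁿ {q : ℕ} (F : FiniteField q) (n k : ℕ) where
  open FiniteField F using (Carrier)
  open Poly F
  open Elements F

  -- A point of Cⁿ, given by the coefficient vectors of its coordinates.
  Code : Set
  Code = Vec (Vec Carrier k) n

  encode : Code → Fin ((q ^ k) ^ n)
  encode = encodeVec (encodeVec index)

  encode-injective : Injective _≡_ _≡_ encode
  encode-injective = encodeVec-injective (encodeVec index) (encodeVec-injective index index-injective)

  decode : Code → Vec B n
  decode = Vec.map sA

  codeOf : ∀ y → InCn n k y → Code
  codeOf y y∈Cⁿ = Vec.tabulate (λ j → proj₁ (y∈Cⁿ j))

  ≈V-decode-codeOf : ∀ y (y∈Cⁿ : InCn n k y) → y ≈V decode (codeOf y y∈Cⁿ)
  ≈V-decode-codeOf y y∈Cⁿ j i = begin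
    coeff (Vec.lookup y j) i                                  ≡⟨ proj₂ (y∈Cⁿ j) i ⟩
    coeff (sA (proj₁ (y∈Cⁿ j))) i                             ≡⟨ cong (λ a → coeff (sA a) i) (Vec.lookup∘tabulate _ j) ⟨
    coeff (sA (Vec.lookup (codeOf y y∈Cⁿ) j)) i                 ≡⟨ cong (λ b → coeff b i) (Vec.lookup-map j sA (codeOf y y∈Cⁿ)) ⟨
    coeff (Vec.lookup (decode (codeOf y y∈Cⁿ)) j) i             ∎
    where open ≡-Reasoning

  codes : (Ys : List (Vec B n)) → All (InCn n k) Ys → List Code
  codes []       []             = []
  codes (y ∷ Ys) (y∈Cⁿ ∷ Ys∈Cⁿ) = codeOf y y∈Cⁿ ∷ codes Ys Ys∈Cⁿ

  length-codes : ∀ Ys Ys∈Cⁿ → length (codes Ys Ys∈Cⁿ) ≡ length Ys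
  length-codes []       []             = refl
  length-codes (y ∷ Ys) (y∈Cⁿ ∷ Ys∈Cⁿ) = cong suc (length-codes Ys Ys∈Cⁿ)

  codes-distinct : ∀ Ys Ys∈Cⁿ → AllPairs (λ y y′ → ¬ (y ≈V y′)) Ys → AllPairs _≢_ (codes Ys Ys∈Cⁿ)
  codes-distinct []       []             []                 = []
  codes-distinct (y ∷ Ys) (y∈Cⁿ ∷ Ys∈Cⁿ) (y≉Ys ∷ distinct) = new Ys Ys∈Cⁿ y≉Ys ∷ codes-distinct Ys Ys∈Cⁿ distinct
    where
    new : ∀ Zs Zs∈Cⁿ → All (λ z → ¬ (y ≈V z)) Zs → All (codeOf y y∈Cⁿ ≢_) (codes Zs Zs∈Cⁿ)
    new []       []             []          = []
    new (z ∷ Zs) (z∈Cⁿ ∷ Zs∈Cⁿ) (y≉z ∷ y≉Zs) =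
      (λ same → y≉z (λ j i → trans (≈V-decode-codeOf y y∈Cⁿ j i)
                               (trans (cong (λ c → coeff (Vec.lookup (decode c) j) i) same)
                                      (sym (≈V-decode-codeOf z z∈Cⁿ j i)))))
      ∷ new Zs Zs∈Cⁿ y≉Zs

  ∈-codes : ∀ {c} Ys Ys∈Cⁿ → c ∈ codes Ys Ys∈Cⁿ → Σ (Vec B n) λ y → y ∈ Ys × y ≈V decode c
  ∈-codes (y ∷ Ys) (y∈Cⁿ ∷ Ys∈Cⁿ) (here refl) = y , here refl , ≈V-decode-codeOf y y∈Cⁿ
  ∈-codes (y ∷ Ys) (y∈Cⁿ ∷ Ys∈Cⁿ) (there c∈) with ∈-codes Ys Ys∈Cⁿ c∈
  ... | z , z∈Ys , z≈c = z , there z∈Ys , z≈c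

  [q^k]^n≡q^[n*k] : (q ^ k) ^ n ≡ q ^ (n * k)
  [q^k]^n≡q^[n*k] = trans (^-*-assoc q k n) (cong (q ^_) (*-comm k n))

  length-distinct-Cⁿ≤ : ∀ {Ys} → All (InCn n k) Ys → AllPairs (λ y y′ → ¬ (y ≈V y′)) Ys → length Ys ≤ q ^ (n * k)
  length-distinct-Cⁿ≤ {Ys} Ys∈Cⁿ distinct = subst₂ _≤_ (length-codes Ys Ys∈Cⁿ) [q^k]^n≡q^[n*k]
    (length-distinct≤ encode encode-injective (codes-distinct Ys Ys∈Cⁿ distinct))

  distinct-Cⁿ-complete : ∀ {Ys} → All (InCn n k) Ys → AllPairs (λ y y′ → ¬ (y ≈V y′)) Ys →
                         q ^ (n * k) ≤ length Ys → ∀ c → Σ (Vec B n) λ y → y ∈ Ys × y ≈V decode c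
  distinct-Cⁿ-complete {Ys} Ys∈Cⁿ distinct long c = ∈-codes Ys Ys∈Cⁿ
    (distinct-complete encode encode-injective (codes-distinct Ys Ys∈Cⁿ distinct)
      (subst₂ _≤_ (sym [q^k]^n≡q^[n*k]) (sym (length-codes Ys Ys∈Cⁿ)) long) c)

module Points {q : ℕ} (F : FiniteField q) (2≤q : 2 ≤ q) where
  open FiniteField F hiding (_*_) renaming (_+_ to _+F_)
  open Poly F
  open PolynomialRing F
  open XAdic F
  open DividedDifferences F
  open Elements F

  private
    instance
      q≢0 : NonZero q
      q≢0 = >-nonZero (≤-trans (s≤s z≤n) 2≤q)
    module K = CommutativeRing F-commutativeRing
  open import Algebra.Properties.Group K.+-group using (x∙y⁻¹≈ε⇒x≈y)
  open BaseQ q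
  open Digits q

  point : ℕ → ℕ → B
  point k i = sA (Vec.map element (digits k i))

  coeff-monomial-≡ : ∀ c m → coeff (monomial c m) m ≡ c
  coeff-monomial-≡ c zero    = refl
  coeff-monomial-≡ c (suc m) = coeff-monomial-≡ c m

  coeff-monomial-≢ : ∀ c m i → i ≢ m → coeff (monomial c m) i ≡ 0#
  coeff-monomial-≢ c zero    zero    i≢m = contradiction refl i≢m
  coeff-monomial-≢ c zero    (suc i) i≢m = refl
  coeff-monomial-≢ c (suc m) zero    i≢m = refl
  coeff-monomial-≢ c (suc m) (suc i) i≢m = coeff-monomial-≢ c m i (i≢m ∘ cong suc)

  coeff-sA-from-below : ∀ {k} j (a : Vec Carrier k) t → t < j → coeff (sA-from j a) (q ^ t) ≡ 0#
  coeff-sA-from-below j []      t _   = refl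
  coeff-sA-from-below j (x ∷ a) t t<j = begin
    coeff (monomial x (q ^ j) +B sA-from (suc j) a) (q ^ t)
      ≡⟨ coeff-+B (monomial x (q ^ j)) (sA-from (suc j) a) (q ^ t) ⟩
    coeff (monomial x (q ^ j)) (q ^ t) +F coeff (sA-from (suc j) a) (q ^ t)
      ≡⟨ cong₂ _+F_ (coeff-monomial-≢ x (q ^ j) (q ^ t) (λ q^t≡q^j → <⇒≢ t<j (^-injectiveʳ q 2≤q q^t≡q^j)))
                   (coeff-sA-from-below (suc j) a t (m<n⇒m<1+n t<j)) ⟩
    0# +F 0#
      ≡⟨ K.+-identityˡ 0# ⟩
    0# ∎
    where open ≡-Reasoning

  coeff-sA-from-digit : ∀ {k} j (a : Vec Carrier k) (t : Fin k) →
                        coeff (sA-from j a) (q ^ (j + toℕ t)) ≡ Vec.lookup a t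
  coeff-sA-from-digit j (x ∷ a) Fin.zero = begin
    coeff (monomial x (q ^ j) +B sA-from (suc j) a) (q ^ (j + 0))
      ≡⟨ cong (λ e → coeff (monomial x (q ^ j) +B sA-from (suc j) a) (q ^ e)) (+-identityʳ j) ⟩
    coeff (monomial x (q ^ j) +B sA-from (suc j) a) (q ^ j)
      ≡⟨ coeff-+B (monomial x (q ^ j)) (sA-from (suc j) a) (q ^ j) ⟩
    coeff (monomial x (q ^ j)) (q ^ j) +F coeff (sA-from (suc j) a) (q ^ j)
      ≡⟨ cong₂ _+F_ (coeff-monomial-≡ x (q ^ j)) (coeff-sA-from-below (suc j) a j ≤-refl) ⟩
    x +F 0#
      ≡⟨ K.+-identityʳ x ⟩
    x ∎
    where open ≡-Reasoning
  coeff-sA-from-digit j (x ∷ a) (Fin.suc t) = begin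
    coeff (monomial x (q ^ j) +B sA-from (suc j) a) (q ^ (j + suc (toℕ t)))
      ≡⟨ coeff-+B (monomial x (q ^ j)) (sA-from (suc j) a) _ ⟩
    coeff (monomial x (q ^ j)) (q ^ (j + suc (toℕ t))) +F coeff (sA-from (suc j) a) (q ^ (j + suc (toℕ t)))
      ≡⟨ cong₂ _+F_ (coeff-monomial-≢ x (q ^ j) _ (λ same → m+1+n≢m j (^-injectiveʳ q 2≤q same)))
                   (cong (λ e → coeff (sA-from (suc j) a) (q ^ e)) (+-suc j (toℕ t))) ⟩
    0# +F coeff (sA-from (suc j) a) (q ^ (suc j + toℕ t))
      ≡⟨ K.+-identityˡ _ ⟩
    coeff (sA-from (suc j) a) (q ^ (suc j + toℕ t))
      ≡⟨ coeff-sA-from-digit (suc j) a t ⟩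
    Vec.lookup a t ∎
    where open ≡-Reasoning

  coeff-point : ∀ k i (t : Fin k) → coeff (point k i) (q ^ toℕ t) ≡ element (Vec.lookup (digits k i) t)
  coeff-point k i t = trans (coeff-sA-from-digit 0 (Vec.map element (digits k i)) t) (Vec.lookup-map t element (digits k i))

  -- Two points first differ in the coefficient of X^(q^t), where q ^ t ∣ i ∸ l.
  point-separation : ∀ k i l → i < q ^ k → l < i → ValXAtMost (point k i -B point k l) (gap k (i ∸ l))
  point-separation k i l i<q^k l<i with firstDifferingDigit k i l i<q^k l<i
  ... | t , q^t∣i∸l , differ =
    q ^ toℕ t , q^≤gap k (toℕ t) (i ∸ l) (Fin.toℕ<n t) q^t∣i∸l (m<n⇒0<n∸m l<i) , coeff≢0
    where
    coeff≢0 : coeff (point k i -B point k l) (q ^ toℕ t) ≢ 0#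
    coeff≢0 coeff≡0 = differ (Bijection.injective enumeration (x∙y⁻¹≈ε⇒x≈y _ _ (begin
      element (Vec.lookup (digits k i) t) +F - element (Vec.lookup (digits k l) t)
        ≡⟨ cong₂ (λ a b → a +F - b) (coeff-point k i t) (coeff-point k l t) ⟨
      coeff (point k i) (q ^ toℕ t) +F - coeff (point k l) (q ^ toℕ t)
        ≡⟨ cong (coeff (point k i) (q ^ toℕ t) +F_) (coeff--B (point k l) _) ⟨
      coeff (point k i) (q ^ toℕ t) +F coeff (-B point k l) (q ^ toℕ t)
        ≡⟨ coeff-+B (point k i) (-B point k l) _ ⟨
      coeff (point k i -B point k l) (q ^ toℕ t)
        ≡⟨ coeff≡0 ⟩
      0# ∎)))
      where open ≡-Reasoning

  -- With β j i = k d ∸ Φ k i j, the loss gap k (i ∸ j) at step j is paid for by Φ-suc,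
  -- and Φ ≤ k d keeps the truncated subtraction exact.
  X^∣-leading-at-points : ∀ k d (p : Vec B (suc d)) T → d < q ^ k →
    (∀ i → i ≤ d → X^ (T + k * d) ∣ horner p (point k i)) → X^ T ∣ leading p
  X^∣-leading-at-points k d p T d<q^k X^∣values =
    X^∣-weaken {leading p} (m≤m+n T _)
      (X^∣-leading d p (point k) (λ i l → gap k (i ∸ l)) β T
        (λ l i l<i i≤d → point-separation k i l (≤-<-trans i≤d d<q^k) l<i)
        potentials
        (λ i i≤d → subst (λ m → X^ T + m ∣ horner p (point k i)) (sym (β₀ i)) (X^∣values i i≤d)))
    where
    β : ℕ → ℕ → ℕ
    β j i = k * d ∸ Φ k i j
    β₀ : ∀ i → β 0 i ≡ k * d
    β₀ i = cong (k * d ∸_) (Φ-zero k i)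
    potentials : ∀ j i → j < i → i ≤ d →
                 (β (suc j) i + gap k (i ∸ j) ≤ β j i) × (β (suc j) i + gap k (i ∸ j) ≤ β j j)
    potentials j i j<i i≤d =
      ≤-reflexive paid , ≤-trans (≤-reflexive paid) (∸-monoʳ-≤ (k * d) (Φ-monoʳ k j (<⇒≤ j<i)))
      where
      Φ+gap≤kd : Φ k i j + gap k (i ∸ j) ≤ k * d
      Φ+gap≤kd = ≤-trans (≤-reflexive (sym (Φ-suc k i j j<i))) (≤-trans (Φ≤k*i k i (suc j)) (*-monoʳ-≤ k i≤d))
      paid : β (suc j) i + gap k (i ∸ j) ≡ β j i
      paid = begin
        (k * d ∸ Φ k i (suc j)) + gap k (i ∸ j)
          ≡⟨ cong (λ φ → (k * d ∸ φ) + gap k (i ∸ j)) (Φ-suc k i j j<i) ⟩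
        (k * d ∸ (Φ k i j + gap k (i ∸ j))) + gap k (i ∸ j)
          ≡⟨ cong (_+ gap k (i ∸ j)) (∸-+-assoc (k * d) (Φ k i j) _) ⟨
        (k * d ∸ Φ k i j ∸ gap k (i ∸ j)) + gap k (i ∸ j)
          ≡⟨ m∸n+n≡m (≤-trans (≤-reflexive (sym (m+n∸m≡n (Φ k i j) _))) (∸-monoˡ-≤ (Φ k i j) Φ+gap≤kd)) ⟩
        k * d ∸ Φ k i j ∎
        where open ≡-Reasoning

module Multivariate {q : ℕ} (F : FiniteField q) where
  open Poly F
  open PolynomialRing F
  open DividedDifferences F
  open SetoidReasoning B-setoid

  sumB-++ : ∀ xs ys → sumB (xs ++ ys) ≋ (sumB xs +B sumB ys)
  sumB-++ []       ys = ≋-refl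
  sumB-++ (x ∷ xs) ys = ≋-trans (+B-cong (≋-refl {x}) (sumB-++ xs ys)) (≋-sym (+B-assoc x (sumB xs) (sumB ys)))

  module _ {X : Set} where

    sumB-map-cong : ∀ (h h′ : X → B) xs → (∀ x → h x ≋ h′ x) → sumB (List.map h xs) ≋ sumB (List.map h′ xs)
    sumB-map-cong h h′ []       h≋h′ = ≋-refl
    sumB-map-cong h h′ (x ∷ xs) h≋h′ = +B-cong (h≋h′ x) (sumB-map-cong h h′ xs h≋h′)

    sumB-map-scale : ∀ c (h : X → B) xs → sumB (List.map (λ x → c *B h x) xs) ≋ (c *B sumB (List.map h xs))
    sumB-map-scale c h []       = ≋-sym (*B-zeroʳ c)
    sumB-map-scale c h (x ∷ xs) = ≋-trans (+B-cong (≋-refl {c *B h x}) (sumB-map-scale c h xs))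
                                          (≋-sym (*B-distribˡ c (h x) (sumB (List.map h xs))))

    sumB-map-zero : ∀ (h : X → B) xs → (∀ x → h x ≋ 0B) → sumB (List.map h xs) ≋ 0B
    sumB-map-zero h []       h≋0 = ≋-refl
    sumB-map-zero h (x ∷ xs) h≋0 = ≋-trans (+B-cong (h≋0 x) (sumB-map-zero h xs h≋0)) (+B-identityˡ 0B)

    sumB-map-concatMap : ∀ {Y : Set} (h : Y → B) (g : X → List Y) xs →
      sumB (List.map h (concatMap g xs)) ≋ sumB (List.map (λ x → sumB (List.map h (g x))) xs)
    sumB-map-concatMap h g []       = ≋-refl
    sumB-map-concatMap h g (x ∷ xs) = begin
      sumB (List.map h (g x ++ concatMap g xs))
        ≡⟨ cong sumB (List.map-++ h (g x) (concatMap g xs)) ⟩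
      sumB (List.map h (g x) ++ List.map h (concatMap g xs))
        ≈⟨ sumB-++ (List.map h (g x)) _ ⟩
      sumB (List.map h (g x)) +B sumB (List.map h (concatMap g xs))
        ≈⟨ +B-cong (≋-refl {sumB (List.map h (g x))}) (sumB-map-concatMap h g xs) ⟩
      sumB (List.map h (g x)) +B sumB (List.map (λ x → sumB (List.map h (g x))) xs) ∎

  sumB-applyUpTo-cong : ∀ (h h′ : ℕ → B) N → (∀ i → h i ≋ h′ i) → sumB (applyUpTo h N) ≋ sumB (applyUpTo h′ N)
  sumB-applyUpTo-cong h h′ zero    h≋h′ = ≋-refl
  sumB-applyUpTo-cong h h′ (suc N) h≋h′ =
    +B-cong (h≋h′ 0) (sumB-applyUpTo-cong (λ i → h (suc i)) (λ i → h′ (suc i)) N (λ i → h≋h′ (suc i)))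

  sumB-applyUpTo-scale : ∀ c (h : ℕ → B) N → sumB (applyUpTo (λ i → c *B h i) N) ≋ (c *B sumB (applyUpTo h N))
  sumB-applyUpTo-scale c h zero    = ≋-sym (*B-zeroʳ c)
  sumB-applyUpTo-scale c h (suc N) = ≋-trans (+B-cong (≋-refl {c *B h 0}) (sumB-applyUpTo-scale c (λ i → h (suc i)) N))
                                             (≋-sym (*B-distribˡ c (h 0) _))

  sumB-applyUpTo-pad : ∀ (h : ℕ → B) M r → (∀ i → M ≤ i → h i ≋ 0B) →
                       sumB (applyUpTo h (M + r)) ≋ sumB (applyUpTo h M)
  sumB-applyUpTo-pad h zero    zero    h≋0 = ≋-refl
  sumB-applyUpTo-pad h zero    (suc r) h≋0 =
    +B-cong (h≋0 0 z≤n) (sumB-applyUpTo-pad (λ i → h (suc i)) zero r (λ i _ → h≋0 (suc i) z≤n))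
  sumB-applyUpTo-pad h (suc M) r       h≋0 =
    +B-cong (≋-refl {h 0}) (sumB-applyUpTo-pad (λ i → h (suc i)) M r (λ i M≤i → h≋0 (suc i) (s≤s M≤i)))

  sumB-applyUpTo-trunc : ∀ (h : ℕ → B) N M → (∀ i → N ≤ i → h i ≋ 0B) → (∀ i → M ≤ i → h i ≋ 0B) →
                         sumB (applyUpTo h N) ≋ sumB (applyUpTo h M)
  sumB-applyUpTo-trunc h N M h≋0-from-N h≋0-from-M with ≤-total N M
  ... | inj₁ N≤M = subst (λ m → sumB (applyUpTo h N) ≋ sumB (applyUpTo h m)) (m+[n∸m]≡n N≤M)
                         (≋-sym (sumB-applyUpTo-pad h N (M ∸ N) h≋0-from-N))
  ... | inj₂ M≤N = subst (λ n → sumB (applyUpTo h n) ≋ sumB (applyUpTo h M)) (m+[n∸m]≡n M≤N)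
                         (sumB-applyUpTo-pad h M (N ∸ M) h≋0-from-M)

  coefficients : (ℕ → B) → (a : ℕ) → Vec B (suc a)
  coefficients g zero    = g 0 ∷ []
  coefficients g (suc a) = g 0 ∷ coefficients (λ i → g (suc i)) a

  leading-coefficients : ∀ g a → leading (coefficients g a) ≡ g a
  leading-coefficients g zero    = refl
  leading-coefficients g (suc a) = leading-coefficients (λ i → g (suc i)) a

  powerSum≋horner : ∀ (g : ℕ → B) x a →
                    sumB (applyUpTo (λ i → (x ^B i) *B g i) (suc a)) ≋ horner (coefficients g a) x
  powerSum≋horner g x zero    = ≋-trans (+B-identityʳ _) (*B-identityˡ (g 0))
  powerSum≋horner g x (suc a) = +B-cong (*B-identityˡ (g 0)) (begin
    sumB (applyUpTo (λ i → (x *B (x ^B i)) *B g (suc i)) (suc a))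
      ≈⟨ sumB-applyUpTo-cong _ (λ i → x *B ((x ^B i) *B g (suc i))) (suc a) (λ i → *B-assoc x (x ^B i) (g (suc i))) ⟩
    sumB (applyUpTo (λ i → x *B ((x ^B i) *B g (suc i))) (suc a))
      ≈⟨ sumB-applyUpTo-scale x (λ i → (x ^B i) *B g (suc i)) (suc a) ⟩
    x *B sumB (applyUpTo (λ i → (x ^B i) *B g (suc i)) (suc a))
      ≈⟨ *B-cong (≋-refl {x}) (powerSum≋horner (λ i → g (suc i)) x a) ⟩
    x *B horner (coefficients (λ i → g (suc i)) a) x ∎)

  slice : ∀ {n} → MPoly (suc n) → ℕ → MPoly n
  slice f e = record
    { cf      = λ β → cf f (e ∷ β)
    ; bound   = bound f
    ; support = λ β (j , bound≤βⱼ) → support f (e ∷ β) (Fin.suc j , bound≤βⱼ)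
    }

  eval-slices : ∀ {n} (f : MPoly (suc n)) x (y : Vec B n) →
                eval f (x ∷ y) ≋ sumB (applyUpTo (λ e → (x ^B e) *B eval (slice f e) y) (bound f))
  eval-slices {n} f x y = begin
    eval f (x ∷ y)
      ≈⟨ sumB-map-concatMap term row (upTo D) ⟩
    sumB (List.map (λ e → sumB (List.map term (row e))) (upTo D))
      ≈⟨ sumB-map-cong _ (λ e → (x ^B e) *B eval (slice f e) y) (upTo D) row≋ ⟩
    sumB (List.map (λ e → (x ^B e) *B eval (slice f e) y) (upTo D))
      ≡⟨ cong sumB (List.map-upTo _ D) ⟩
    sumB (applyUpTo (λ e → (x ^B e) *B eval (slice f e) y) D) ∎
    where
    D : ℕ
    D = bound f
    term : Vec ℕ (suc n) → B
    term β = cf f β *B monoVal (x ∷ y) β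
    row : ℕ → List (Vec ℕ (suc n))
    row e = List.map (e ∷_) (allExps n D)
    row≋ : ∀ e → sumB (List.map term (row e)) ≋ ((x ^B e) *B eval (slice f e) y)
    row≋ e = begin
      sumB (List.map term (List.map (e ∷_) (allExps n D)))
        ≡⟨ cong sumB (List.map-∘ (allExps n D)) ⟨
      sumB (List.map (λ β → cf f (e ∷ β) *B ((x ^B e) *B monoVal y β)) (allExps n D))
        ≈⟨ sumB-map-cong _ (λ β → (x ^B e) *B (cf f (e ∷ β) *B monoVal y β)) (allExps n D)
             (λ β → solve 3 (λ c X M → (c ⊗ (X ⊗ M)) ⊜ (X ⊗ (c ⊗ M))) ≋-refl (cf f (e ∷ β)) (x ^B e) (monoVal y β)) ⟩
      sumB (List.map (λ β → (x ^B e) *B (cf f (e ∷ β) *B monoVal y β)) (allExps n D))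
        ≈⟨ sumB-map-scale (x ^B e) _ (allExps n D) ⟩
      (x ^B e) *B eval (slice f e) y ∎

  eval-[] : (f : MPoly 0) → eval f [] ≋ cf f []
  eval-[] f = ≋-trans (+B-identityʳ _) (*B-identityʳ _)

  eval-zero : ∀ {n} (f : MPoly n) y → (∀ β → cf f β ≈B 0B) → eval f y ≋ 0B
  eval-zero {n} f y cf≈0 = sumB-map-zero _ (allExps n (bound f))
    (λ β → ≋-trans (*B-cong {cf f β} {0B} (mk≋ (cf≈0 β)) (≋-refl {monoVal y β})) (*B-zeroˡ (monoVal y β)))

  ^B-cong : ∀ {a b} e → a ≋ b → (a ^B e) ≋ (b ^B e)
  ^B-cong zero    a≋b = ≋-refl
  ^B-cong (suc e) a≋b = *B-cong a≋b (^B-cong e a≋b)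

  monoVal-cong : ∀ {n} {y y′ : Vec B n} β → y ≈V y′ → monoVal y β ≋ monoVal y′ β
  monoVal-cong {y = _ ∷ y} {_ ∷ y′} (e ∷ β) y≈y′ =
    *B-cong (^B-cong e (mk≋ (y≈y′ Fin.zero))) (monoVal-cong {y = y} {y′} β (λ j → y≈y′ (Fin.suc j)))
  monoVal-cong {y = []} {[]} [] y≈y′ = ≋-refl

  eval-cong : ∀ {n} (f : MPoly n) {y y′ : Vec B n} → y ≈V y′ → eval f y ≋ eval f y′
  eval-cong {n} f {y} {y′} y≈y′ = sumB-map-cong _ _ (allExps n (bound f))
      (λ β → *B-cong (≋-refl {cf f β}) (monoVal-cong {y = y} {y′} β y≈y′))

module LeadingTerm {q : ℕ} (F : FiniteField q) (2≤q : 2 ≤ q) where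
  open Poly F
  open PolynomialRing F
  open XAdic F
  open DividedDifferences F
  open Points F 2≤q
  open Multivariate F

  -- For fixed z₂, …, zₙ, f is a polynomial in z₁ of degree at most α₁ (α is lex-maximal)
  -- whose z₁^α₁-coefficient is slice f α₁: interpolating in z₁ costs k α₁.
  X^∣-leadingTerm : ∀ k n (f : MPoly n) (α : Vec ℕ n) T →
    (∀ β → α <lex β → cf f β ≈B 0B) → VAll.All (_< q ^ k) α →
    (∀ ms → Pointwise _≤_ ms α → X^ (T + k * sum α) ∣ eval f (Vec.map (point k) ms)) →
    X^ T ∣ cf f α
  X^∣-leadingTerm k zero f [] T lexMax α<q^k X^∣grid =
    X^∣-resp-≋ {eval f []} (eval-[] f) (X^∣-weaken {eval f []} (m≤m+n T (k * 0)) (X^∣grid [] []))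
  X^∣-leadingTerm k (suc n) f (a ∷ α) T lexMax (a<q^k VAll.∷ α<q^k) X^∣grid =
    X^∣-leadingTerm k n (slice f a) α T (λ β α<β → lexMax (a ∷ β) (inj₂ (refl , α<β))) α<q^k X^∣slice-grid
    where
    X^∣slice-grid : ∀ ms → Pointwise _≤_ ms α → X^ (T + k * sum α) ∣ eval (slice f a) (Vec.map (point k) ms)
    X^∣slice-grid ms ms≤α =
      subst (λ b → X^ (T + k * sum α) ∣ b) (leading-coefficients g a)
        (X^∣-leading-at-points k a (coefficients g a) (T + k * sum α) a<q^k X^∣values)
      where
      y : Vec B n
      y = Vec.map (point k) ms
      g : ℕ → B
      g e = eval (slice f e) y
      g≋0-from-bound : ∀ e → bound f ≤ e → g e ≋ 0B
      g≋0-from-bound e bound≤e = eval-zero (slice f e) y (λ β → support f (e ∷ β) (Fin.zero , bound≤e))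
      g≋0-above-a : ∀ e → suc a ≤ e → g e ≋ 0B
      g≋0-above-a e a<e = eval-zero (slice f e) y (λ β → lexMax (e ∷ β) (inj₁ a<e))
      exponents : T + k * (a + sum α) ≡ T + k * sum α + k * a
      exponents = trans (cong (T +_) (trans (*-distribˡ-+ k a (sum α)) (+-comm (k * a) _))) (sym (+-assoc T _ _))
      X^∣values : ∀ i → i ≤ a → X^ (T + k * sum α + k * a) ∣ horner (coefficients g a) (point k i)
      X^∣values i i≤a = subst (λ m → X^ m ∣ horner (coefficients g a) (point k i)) exponents
        (X^∣-resp-≋ {eval f (point k i ∷ y)} f≋horner (X^∣grid (i ∷ ms) (i≤a ∷ ms≤α)))
        where
        open SetoidReasoning B-setoid
        f≋horner : eval f (point k i ∷ y) ≋ horner (coefficients g a) (point k i)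
        f≋horner = begin
          eval f (point k i ∷ y)
            ≈⟨ eval-slices f (point k i) y ⟩
          sumB (applyUpTo (λ e → (point k i ^B e) *B g e) (bound f))
            ≈⟨ sumB-applyUpTo-trunc _ (bound f) (suc a)
                 (λ e bound≤e → ≋-trans (*B-cong (≋-refl {point k i ^B e}) (g≋0-from-bound e bound≤e))
                     (*B-zeroʳ (point k i ^B e)))
                 (λ e a<e → ≋-trans (*B-cong (≋-refl {point k i ^B e}) (g≋0-above-a e a<e)) (*B-zeroʳ (point k i ^B e))) ⟩
          sumB (applyUpTo (λ e → (point k i ^B e) *B g e) (suc a))
            ≈⟨ powerSum≋horner g (point k i) a ⟩
          horner (coefficients g a) (point k i) ∎

module ManyPoints {q : ℕ} (F : FiniteField q) (2≤q : 2 ≤ q) (n k : ℕ) where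
  open Poly F
  open XAdic F
  open Elements F
  open Digits q {{ℕ.>-nonZero (≤-trans (s≤s z≤n) 2≤q)}}
  open Points F 2≤q
  open Multivariate F
  open LeadingTerm F 2≤q
  open CodesOfCⁿ F n k

  -- If Ys exhausts Cⁿ, it contains every grid point (point k m₁, …, point k mₙ).
  leadingCoeff-divisible : ∀ (f : MPoly n) α → (∀ β → α <lex β → cf f β ≈B 0B) → VAll.All (_< q ^ k) α →
    ∀ v (θ : ℚ) → ℕ→ℚ (k * sum α) ℚ.< θ ℚ.* ℕ→ℚ (n * q ^ k) →
    ∀ {Ys} → AllPairs (λ y y′ → ¬ (y ≈V y′)) Ys →
    All (λ y → InCn n k y × ValXAtLeast (eval f y) (ℕ→ℚ v ℚ.+ θ ℚ.* ℕ→ℚ (n * q ^ k))) Ys →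
    q ^ (n * k) ≤ length Ys → XPowDivides (suc v) (cf f α)
  leadingCoeff-divisible f α lexMax α<q^k v θ kA<θM distinct good many =
    X^∣⇒XPowDivides {suc v} {cf f α} (X^∣-leadingTerm k n f α (suc v) lexMax α<q^k X^∣grid)
    where
    X^∣grid : ∀ ms → Pointwise _≤_ ms α → X^ (suc v + k * sum α) ∣ eval f (Vec.map (point k) ms)
    X^∣grid ms _ with distinct-Cⁿ-complete (All.map proj₁ good) distinct many
                        (Vec.map (λ m → Vec.map element (digits k m)) ms)
    ... | y , y∈Ys , y≈grid with All.lookup good y∈Ys
    ...   | _ , m , threshold≤m , X^m∣fy =
      X^∣-resp-≋ {eval f y} {eval f grid} (eval-cong f {y} {grid} y≈grid′)
        (X^∣-weaken {eval f y} (ValXAtLeast-threshold v (k * sum α) m _ kA<θM threshold≤m)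
                               (XPowDivides⇒X^∣ {m} {eval f y} X^m∣fy))
      where
      grid : Vec B n
      grid = Vec.map (point k) ms
      y≈grid′ : y ≈V grid
      y≈grid′ = subst (y ≈V_) (sym (Vec.map-∘ sA _ ms)) y≈grid

lemma4p1 : (q : ℕ) → IsPrimePower q → (F : FiniteField q) →
    (n k : ℕ) → 1 ≤ n → 1 ≤ k →
    let open Poly F in
    (f : MPoly n) (α : Vec ℕ n) → IsLeadingTerm f α →
    VAll.All (λ a → a < q ^ k) α →
    (v : ℕ) → IsValX (cf f α) v →
    (θ : ℚ) → .{{_ : Positive θ}} → θ ℚ.≤ ℚ.1ℚ →
    (Ys : List (Vec B n)) →
    AllPairs (λ y y′ → ¬ (y ≈V y′)) Ys →
    All (λ y → InCn n k y × ValXAtLeast (eval f y) (ℕ→ℚ v ℚ.+ θ ℚ.* ℕ→ℚ (n * q ^ k))) Ys →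
    ℕ→ℚ (length Ys) ℚ.< (ℕ→ℚ (q ^ (n * k)) ℚ.⊔ divPos (ℕ→ℚ (sum α * k * q ^ (k * (n ∸ 1) + 1))) θ)
lemma4p1 q q-pp F n k 1≤n _ f α (_ , lexMax) α<q^k v (_ , X^v+1∤cα) θ _ Ys distinct good
  with ℕ→ℚ (k * sum α) ℚ.<? θ ℚ.* ℕ→ℚ (n * q ^ k)
... | no kA≮θM = ℚ.<-≤-trans
  (≤q^nk⇒<bound/θ q n k (sum α) (length Ys) θ (IsPrimePower⇒2≤ q-pp) {{ℕ.>-nonZero 1≤n}} (ℚ.≮⇒≥ kA≮θM)
     (CodesOfCⁿ.length-distinct-Cⁿ≤ F n k (All.map proj₁ good) distinct))
  (ℚ.p≤q⊔p (ℕ→ℚ (q ^ (n * k))) _)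
... | yes kA<θM with length Ys <? q ^ (n * k)
...   | yes few  = ℚ.<-≤-trans (ℕ→ℚ-mono-< few) (ℚ.p≤p⊔q _ (divPos (ℕ→ℚ (sum α * k * q ^ (k * (n ∸ 1) + 1))) θ))
...   | no  many = contradiction
  (ManyPoints.leadingCoeff-divisible F (IsPrimePower⇒2≤ q-pp) n k f α lexMax α<q^k v θ kA<θM distinct good (≮⇒≥ many))
  X^v+1∤cα
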